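{- For every integer $d\ge 2$ and every $n\ge d$ there exists an ACS $(n,d)$-polytope.
   Context: An ACS (alternating centrally symmetric) $(n,d)$-polytope is a convex polytope $P\subset\mathbb{R}^d$ with $2n$ centrally symmetric vertices $p_1,-p_1,\ldots,p_n,-p_n$ such that the simplices spanned by vertices of $P$ that contain the origin in their (relative) interior are exactly the edges $[p_i,-p_i]$ ($1\le i\le n$) and the $d$-simplices with vertex sets $\{p_{k_0},-p_{k_1},p_{k_2},\ldots,(-1)^dp_{k_d}\}$ and $\{ -p_{k_0},p_{k_1},\ldots,(-1)^{d+1}p_{k_d}\}$ for $1\le k_0<k_1<\cdots<k_d\le n$. -}

module Defs where

open import Data.Nat using (ℕ; zero; suc)
open import Data.Nat as ℕ using ()
open import Data.Fin using (Fin; toℕ) renaming (_<_ to _<ᶠ_)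
open import Data.Bool using (Bool; true; false; not; if_then_else_)
open import Data.Product using (Σ; ∃; _×_; _,_)
open import Data.Sum using (_⊎_)
open import Relation.Binary.PropositionalEquality using (_≡_; _≢_)
open import Relation.Nullary using (¬_)
open import Function.Bundles using (_⇔_)

-- The real numbers, axiomatised as a complete ordered field.
-- (Any two complete ordered fields are isomorphic, so quantifying over
-- all models of this record is the same as talking about ℝ.)

record RealField : Set₁ where
  infixl 6 _+_
  infixl 7 _*_
  infix 4 _<_
  field
    Carrier : Set
    0# 1#   : Carrier
    _+_ _*_ : Carrier → Carrier → Carrier
    -_      : Carrier → Carrier
    _<_     : Carrier → Carrier → Set
    +-assoc  : ∀ x y z → (x + y) + z ≡ x + (y + z)
    +-comm   : ∀ x y → x + y ≡ y + x
    +-idˡ    : ∀ x → 0# + x ≡ x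
    -‿invˡ   : ∀ x → (- x) + x ≡ 0#
    *-assoc  : ∀ x y z → (x * y) * z ≡ x * (y * z)
    *-comm   : ∀ x y → x * y ≡ y * x
    *-idˡ    : ∀ x → 1# * x ≡ x
    distribˡ : ∀ x y z → x * (y + z) ≡ (x * y) + (x * z)
    0≢1      : 0# ≢ 1#
    *-inv    : ∀ x → x ≢ 0# → ∃ λ y → x * y ≡ 1#
    <-irrefl : ∀ x → ¬ (x < x)
    <-trans  : ∀ {x y z} → x < y → y < z → x < z
    <-tri    : ∀ x y → x < y ⊎ x ≡ y ⊎ y < x
    +-mono-< : ∀ {x y} z → x < y → x + z < y + z
    *-pos    : ∀ {x y} → 0# < x → 0# < y → 0# < x * y
  _≤_ : Carrier → Carrier → Set
  x ≤ y = x < y ⊎ x ≡ y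
  field
    lub : (P : Carrier → Set) → ∃ P → (∃ λ b → ∀ x → P x → x ≤ b) →
          ∃ λ s → (∀ x → P x → x ≤ s) × (∀ b → (∀ x → P x → x ≤ b) → s ≤ b)

module Geometry (R : RealField) where
  open RealField R

  sumF : ∀ {n} → (Fin n → Carrier) → Carrier
  sumF {zero}  f = 0#
  sumF {suc n} f = f Fin.zero + sumF (λ i → f (Fin.suc i))
    where import Data.Fin as Fin

  -- sums over the 2n signed indices (i , s), s = true ↦ +p_i, s = false ↦ -p_i
  sum2 : ∀ {n} → (Fin n → Bool → Carrier) → Carrier
  sum2 f = sumF (λ i → f i true + f i false)

  Point : ℕ → Set
  Point d = Fin d → Carrier

  module Config {n d : ℕ} (p : Fin n → Point d) where

    v : Fin n → Bool → Point d
    v i true  = p i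
    v i false = λ c → - p i c

    VSet : Set
    VSet = Fin n → Bool → Bool

    Coeffs : Set
    Coeffs = Fin n → Bool → Carrier

    SupportedOn : Coeffs → VSet → Set
    SupportedOn μ S = ∀ i s → S i s ≡ false → μ i s ≡ 0#

    comb : Coeffs → Point d
    comb μ c = sum2 (λ i s → μ i s * v i s c)

    AffinelyIndependent : VSet → Set
    AffinelyIndependent S = ∀ μ → SupportedOn μ S → sum2 μ ≡ 0# →
      (∀ c → comb μ c ≡ 0#) → ∀ i s → μ i s ≡ 0#

    -- the origin is in the relative interior of conv(S)
    -- (for affinely independent S: a strictly positive convex combination)
    OriginInRelInt : VSet → Set
    OriginInRelInt S = Σ Coeffs λ μ → SupportedOn μ S ×
      (∀ i s → S i s ≡ true → 0# < μ i s) × sum2 μ ≡ 1# × (∀ c → comb μ c ≡ 0#)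

    SimplexThroughOrigin : VSet → Set
    SimplexThroughOrigin S = AffinelyIndependent S × OriginInRelInt S

    -- the 2n points are exactly the vertices of P = conv{±p_i}:
    -- none lies in the convex hull of the other ones
    AllVertices : Set
    AllVertices = ∀ i s → ¬ (Σ Coeffs λ μ → (∀ j t → 0# ≤ μ j t) × μ i s ≡ 0# ×
      sum2 μ ≡ 1# × (∀ c → comb μ c ≡ v i s c))

    IsEdge : VSet → Set
    IsEdge S = ∃ λ i → ∀ j s → (S j s ≡ true) ⇔ (j ≡ i)

    alt : Bool → ℕ → Bool
    alt b zero    = b
    alt b (suc m) = not (alt b m)

    IsAlternating : VSet → Set
    IsAlternating S = Σ (Fin (suc d) → Fin n) λ k →
      (∀ a b → a <ᶠ b → k a <ᶠ k b) × Σ Bool λ b →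
      ∀ j s → (S j s ≡ true) ⇔ (∃ λ a → k a ≡ j × s ≡ alt b (toℕ a))

  IsACS : (n d : ℕ) → (Fin n → Point d) → Set
  IsACS n d p = AllVertices ×
    (∀ S → SimplexThroughOrigin S ⇔ (IsEdge S ⊎ IsAlternating S))
    where open Config p

-- Take p_j = x_j (1, t_j, t_j², …, t_j^(d-1)) with y_j = j, x_j = n² − j² > 0 and
-- t_j = y_j / x_j, so that the first two coordinates of p_j are (x_j, y_j) and the
-- nodes t_j increase strictly with j.  The functional P ↦ P₀ + 2 y_i P₁ takes the
-- value n² + y_i² − (y_i − y_j)² at p_j, so it is maximised over all ±p_j only at
-- p_i: every ±p_i is a vertex.  A relation Σ λ_j p_j = 0 is the system
-- Σ λ_j x_j t_j^e = 0 (e < d); pairing it with the polynomial of degree < d that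
-- vanishes at all nodes but one, or all but two adjacent ones, shows that such a
-- relation on at most d points is trivial, and that on d + 1 points its coefficients
-- are all nonzero and alternate in sign.  For a simplex containing the origin in its
-- relative interior put λ_j = (weight of p_j) − (weight of −p_j): either the simplex
-- contains an antipodal pair, and affine independence makes it that edge, or it has
-- exactly d + 1 vertices whose signs alternate.  Conversely, the kernel vector of the
-- d equations in d + 1 unknowns, suitably normalised, puts the origin inside every
-- alternating simplex.
module Submission where

open import Defs
open import Algebra.Bundles using (CommutativeRing)
open import Algebra.Solver.Ring.AlmostCommutativeRing
  using (AlmostCommutativeRing; fromCommutativeRing; _-Raw-AlmostCommutative⟶_)
open import Agda.Builtin.Int using (pos; negsuc)
open import Data.Bool using (Bool; true; false; not; if_then_else_; _∨_)
import Data.Bool.Properties as Boolₚ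
open import Data.Empty using (⊥; ⊥-elim)
open import Data.Fin as Fin using (Fin; zero; suc; toℕ)
import Data.Fin.Properties as Finₚ
open import Data.Integer as ℤ using (ℤ)
import Data.Integer.Properties as ℤₚ
open import Data.List using (List; []; _∷_; length)
open import Data.Maybe using (Maybe; just; nothing)
open import Data.Nat as ℕ using (ℕ)
import Data.Nat.Properties as ℕₚ
open import Data.Product using (Σ; ∃; _×_; _,_; proj₁; proj₂)
open import Data.Sign as Sign using (Sign)
open import Data.Sum using (_⊎_; inj₁; inj₂; [_,_]′)
open import Function using (_∘_)
open import Function.Bundles using (_⇔_; mk⇔; Equivalence)
open import Relation.Binary.Definitions using (tri<; tri≈; tri>)
open import Relation.Binary.PropositionalEquality
open import Relation.Nullary using (¬_; Dec; yes; no; does)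
open import Relation.Nullary.Decidable using (_×-dec_; ¬?; decidable-stable; dec-true; dec-false)

module OrderedFieldProperties (R : RealField) where
  open RealField R public

  +-identityʳ : ∀ x → x + 0# ≡ x
  +-identityʳ x = trans (+-comm x 0#) (+-idˡ x)

  -‿inverseʳ : ∀ x → x + - x ≡ 0#
  -‿inverseʳ x = trans (+-comm x (- x)) (-‿invˡ x)

  *-identityʳ : ∀ x → x * 1# ≡ x
  *-identityʳ x = trans (*-comm x 1#) (*-idˡ x)

  distribʳ : ∀ x y z → (y + z) * x ≡ y * x + z * x
  distribʳ x y z = begin
    (y + z) * x    ≡⟨ *-comm (y + z) x ⟩
    x * (y + z)    ≡⟨ distribˡ x y z ⟩
    x * y + x * z  ≡⟨ cong₂ _+_ (*-comm x y) (*-comm x z) ⟩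
    y * x + z * x  ∎
    where open ≡-Reasoning

  commutativeRing : CommutativeRing _ _
  commutativeRing = record
    { isCommutativeRing = record
      { isRing = record
        { +-isAbelianGroup = record
          { isGroup = record
            { isMonoid = record
              { isSemigroup = record
                { isMagma = record { isEquivalence = isEquivalence ; ∙-cong = cong₂ _+_ }
                ; assoc = +-assoc }
              ; identity = +-idˡ , +-identityʳ }
            ; inverse = -‿invˡ , -‿inverseʳ
            ; ⁻¹-cong = cong -_ }
          ; comm = +-comm }
        ; *-cong = cong₂ _*_
        ; *-assoc = *-assoc
        ; *-identity = *-idˡ , *-identityʳ
        ; distrib = distribˡ , distribʳ }
      ; *-comm = *-comm } }

  open CommutativeRing commutativeRing public using (zeroˡ; zeroʳ)
  open import Algebra.Properties.Ring (CommutativeRing.ring commutativeRing) public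
    using (-‿involutive; -0#≈0#; -‿anti-homo-+; -‿distribˡ-*; -‿distribʳ-*)

  -x*-y≡x*y : ∀ x y → - x * - y ≡ x * y
  -x*-y≡x*y x y = trans (sym (-‿distribˡ-* x (- y))) (trans (cong -_ (sym (-‿distribʳ-* x y))) (-‿involutive _))

  x+y≡0⇒y≡-x : ∀ {x y} → x + y ≡ 0# → y ≡ - x
  x+y≡0⇒y≡-x {x} {y} x+y≡0 = begin
    y                ≡⟨ sym (+-idˡ y) ⟩
    0# + y           ≡⟨ cong (_+ y) (sym (-‿invˡ x)) ⟩
    - x + x + y      ≡⟨ +-assoc (- x) x y ⟩
    - x + (x + y)    ≡⟨ cong (- x +_) x+y≡0 ⟩
    - x + 0#         ≡⟨ +-identityʳ (- x) ⟩
    - x              ∎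
    where open ≡-Reasoning

  x+-y≡0⇒y≡x : ∀ {x y} → x + - y ≡ 0# → y ≡ x
  x+-y≡0⇒y≡x {x} {y} x-y≡0 = trans (sym (-‿involutive y)) (trans (cong -_ (x+y≡0⇒y≡-x x-y≡0)) (-‿involutive x))

  y≢x⇒y-x≢0 : ∀ {x y} → y ≢ x → y + - x ≢ 0#
  y≢x⇒y-x≢0 {x} {y} y≢x y-x≡0 = y≢x (begin
    y                ≡⟨ sym (+-identityʳ y) ⟩
    y + 0#           ≡⟨ cong (y +_) (sym (-‿invˡ x)) ⟩
    y + (- x + x)    ≡⟨ sym (+-assoc y (- x) x) ⟩
    y + - x + x      ≡⟨ cong (_+ x) y-x≡0 ⟩
    0# + x           ≡⟨ +-idˡ x ⟩
    x                ∎)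
    where open ≡-Reasoning

  <⇒≢ : ∀ {x y} → x < y → x ≢ y
  <⇒≢ {x} x<x refl = <-irrefl x x<x

  <⇒≢′ : ∀ {x y} → x < y → y ≢ x
  <⇒≢′ x<y = ≢-sym (<⇒≢ x<y)

  <-asym : ∀ {x y} → x < y → ¬ (y < x)
  <-asym {x} x<y y<x = <-irrefl x (<-trans x<y y<x)

  _≟0 : ∀ x → Dec (x ≡ 0#)
  x ≟0 with <-tri x 0#
  ... | inj₁ x<0 = no (<⇒≢ x<0)
  ... | inj₂ (inj₁ x≡0) = yes x≡0
  ... | inj₂ (inj₂ 0<x) = no (<⇒≢′ 0<x)

  x<y⇒0<y-x : ∀ {x y} → x < y → 0# < y + - x
  x<y⇒0<y-x {x} x<y = subst (_< _) (-‿inverseʳ x) (+-mono-< (- x) x<y)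

  0<y-x⇒x<y : ∀ {x y} → 0# < y + - x → x < y
  0<y-x⇒x<y {x} {y} 0<y-x = subst₂ _<_ (+-idˡ x) y-x+x≡y (+-mono-< x 0<y-x)
    where
    y-x+x≡y : y + - x + x ≡ y
    y-x+x≡y = trans (+-assoc y (- x) x) (trans (cong (y +_) (-‿invˡ x)) (+-identityʳ y))

  x<0⇒0<-x : ∀ {x} → x < 0# → 0# < - x
  x<0⇒0<-x {x} x<0 = subst₂ _<_ (-‿inverseʳ x) (+-idˡ (- x)) (+-mono-< (- x) x<0)

  0<x⇒-x<0 : ∀ {x} → 0# < x → - x < 0#
  0<x⇒-x<0 {x} 0<x = subst₂ _<_ (+-idˡ (- x)) (-‿inverseʳ x) (+-mono-< (- x) 0<x)

  0<-x⇒x<0 : ∀ {x} → 0# < - x → x < 0#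
  0<-x⇒x<0 {x} 0<-x = subst (_< 0#) (-‿involutive x) (0<x⇒-x<0 0<-x)

  x<y⇒x-y<0 : ∀ {x y} → x < y → x + - y < 0#
  x<y⇒x-y<0 {x} {y} x<y = subst (_< 0#) -[y-x]≡x-y (0<x⇒-x<0 (x<y⇒0<y-x x<y))
    where
    -[y-x]≡x-y : - (y + - x) ≡ x + - y
    -[y-x]≡x-y = trans (-‿anti-homo-+ y (- x)) (cong (_+ - y) (-‿involutive x))

  *-neg-neg : ∀ {x y} → x < 0# → y < 0# → 0# < x * y
  *-neg-neg {x} {y} x<0 y<0 = subst (0# <_) (-x*-y≡x*y x y) (*-pos (x<0⇒0<-x x<0) (x<0⇒0<-x y<0))

  *-pos-neg : ∀ {x y} → 0# < x → y < 0# → x * y < 0#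
  *-pos-neg {x} {y} 0<x y<0 =
    0<-x⇒x<0 (subst (0# <_) (sym (-‿distribʳ-* x y)) (*-pos 0<x (x<0⇒0<-x y<0)))

  x≢0⇒0<x*x : ∀ {x} → x ≢ 0# → 0# < x * x
  x≢0⇒0<x*x {x} x≢0 with <-tri x 0#
  ... | inj₁ x<0 = *-neg-neg x<0 x<0
  ... | inj₂ (inj₁ x≡0) = ⊥-elim (x≢0 x≡0)
  ... | inj₂ (inj₂ 0<x) = *-pos 0<x 0<x

  0<1 : 0# < 1#
  0<1 = subst (0# <_) (*-idˡ 1#) (x≢0⇒0<x*x (≢-sym 0≢1))

  +-pos-nonneg : ∀ {x y} → 0# < x → 0# ≤ y → 0# < x + y
  +-pos-nonneg {x} 0<x (inj₁ 0<y) = <-trans 0<y (subst (_< x + _) (+-idˡ _) (+-mono-< _ 0<x))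
  +-pos-nonneg {x} 0<x (inj₂ refl) = subst (0# <_) (sym (+-identityʳ x)) 0<x

  +-pos : ∀ {x y} → 0# < x → 0# < y → 0# < x + y
  +-pos 0<x 0<y = +-pos-nonneg 0<x (inj₁ 0<y)

  +-nonneg : ∀ {x y} → 0# ≤ x → 0# ≤ y → 0# ≤ (x + y)
  +-nonneg (inj₁ 0<x) 0≤y = inj₁ (+-pos-nonneg 0<x 0≤y)
  +-nonneg {y = y} (inj₂ refl) 0≤y = subst (0# ≤_) (sym (+-idˡ y)) 0≤y

  *-nonneg : ∀ {x y} → 0# ≤ x → 0# ≤ y → 0# ≤ (x * y)
  *-nonneg (inj₁ 0<x) (inj₁ 0<y) = inj₁ (*-pos 0<x 0<y)
  *-nonneg {x} (inj₁ _) (inj₂ refl) = inj₂ (sym (zeroʳ x))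
  *-nonneg {y = y} (inj₂ refl) _ = inj₂ (sym (zeroˡ y))

  0<y*x⇒0<x : ∀ {x y} → 0# < y → 0# < x * y → 0# < x
  0<y*x⇒0<x {x} {y} 0<y 0<xy with <-tri x 0#
  ... | inj₁ x<0 = ⊥-elim (<-asym 0<xy (subst (_< 0#) (*-comm y x) (*-pos-neg 0<y x<0)))
  ... | inj₂ (inj₁ refl) = ⊥-elim (<-irrefl 0# (subst (0# <_) (zeroˡ y) 0<xy))
  ... | inj₂ (inj₂ 0<x) = 0<x

  x*y<0⇒x<0 : ∀ {x y} → 0# < y → x * y < 0# → x < 0#
  x*y<0⇒x<0 {x} {y} 0<y xy<0 = 0<-x⇒x<0 (0<y*x⇒0<x 0<y (subst (0# <_) (-‿distribˡ-* x y) (x<0⇒0<-x xy<0)))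

  0<x*y⇒x≢0 : ∀ {x y} → 0# < x * y → x ≢ 0#
  0<x*y⇒x≢0 {y = y} 0<xy refl = <-irrefl 0# (subst (0# <_) (zeroˡ y) 0<xy)

  _⁻¹⟨_⟩ : (x : Carrier) → x ≢ 0# → Carrier
  x ⁻¹⟨ x≢0 ⟩ = proj₁ (*-inv x x≢0)

  *-inverseʳ : ∀ x (x≢0 : x ≢ 0#) → x * x ⁻¹⟨ x≢0 ⟩ ≡ 1#
  *-inverseʳ x x≢0 = proj₂ (*-inv x x≢0)

  *-≢0 : ∀ {x y} → x ≢ 0# → y ≢ 0# → x * y ≢ 0#
  *-≢0 {x} {y} x≢0 y≢0 xy≡0 = 0≢1 (begin
    0#                                     ≡⟨ sym (zeroˡ _) ⟩
    0# * (x ⁻¹⟨ x≢0 ⟩ * y ⁻¹⟨ y≢0 ⟩)       ≡⟨ cong (_* (x ⁻¹⟨ x≢0 ⟩ * y ⁻¹⟨ y≢0 ⟩)) (sym xy≡0) ⟩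
    x * y * (x ⁻¹⟨ x≢0 ⟩ * y ⁻¹⟨ y≢0 ⟩)    ≡⟨ regroup x y _ _ ⟩
    (x * x ⁻¹⟨ x≢0 ⟩) * (y * y ⁻¹⟨ y≢0 ⟩)  ≡⟨ cong₂ _*_ (*-inverseʳ x x≢0) (*-inverseʳ y y≢0) ⟩
    1# * 1#                                ≡⟨ *-idˡ 1# ⟩
    1#                                     ∎)
    where
    open ≡-Reasoning
    regroup : ∀ a b c e → a * b * (c * e) ≡ (a * c) * (b * e)
    regroup a b c e = begin
      a * b * (c * e)    ≡⟨ *-assoc a b (c * e) ⟩
      a * (b * (c * e))  ≡⟨ cong (a *_) (trans (sym (*-assoc b c e)) (cong (_* e) (*-comm b c))) ⟩
      a * (c * b * e)    ≡⟨ cong (a *_) (*-assoc c b e) ⟩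
      a * (c * (b * e))  ≡⟨ sym (*-assoc a c (b * e)) ⟩
      a * c * (b * e)    ∎

  integralˡ : ∀ {x y} → x ≢ 0# → x * y ≡ 0# → y ≡ 0#
  integralˡ {y = y} x≢0 xy≡0 with y ≟0
  ... | yes y≡0 = y≡0
  ... | no y≢0 = ⊥-elim (*-≢0 x≢0 y≢0 xy≡0)

  integralʳ : ∀ {x y} → y ≢ 0# → x * y ≡ 0# → x ≡ 0#
  integralʳ {x} {y} y≢0 xy≡0 = integralˡ y≢0 (trans (*-comm y x) xy≡0)

  x*y≢0⇒x≢0 : ∀ {x y} → x * y ≢ 0# → x ≢ 0#
  x*y≢0⇒x≢0 {y = y} xy≢0 refl = xy≢0 (zeroˡ y)

  x*y≢0⇒y≢0 : ∀ {x y} → x * y ≢ 0# → y ≢ 0#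
  x*y≢0⇒y≢0 {x} xy≢0 refl = xy≢0 (zeroʳ x)

  ⁻¹-pos : ∀ {x} (x≢0 : x ≢ 0#) → 0# < x → 0# < x ⁻¹⟨ x≢0 ⟩
  ⁻¹-pos {x} x≢0 0<x with <-tri (x ⁻¹⟨ x≢0 ⟩) 0#
  ... | inj₁ x⁻¹<0 = ⊥-elim (<-asym 0<1 (subst (_< 0#) (*-inverseʳ x x≢0) (*-pos-neg 0<x x⁻¹<0)))
  ... | inj₂ (inj₁ x⁻¹≡0) = ⊥-elim (0≢1 (trans (sym (zeroʳ x)) (trans (cong (x *_) (sym x⁻¹≡0)) (*-inverseʳ x x≢0))))
  ... | inj₂ (inj₂ 0<x⁻¹) = 0<x⁻¹

  0<2 : 0# < 1# + 1#
  0<2 = +-pos 0<1 0<1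

  ½ : Carrier
  ½ = (1# + 1#) ⁻¹⟨ <⇒≢′ 0<2 ⟩

  ½-pos : 0# < ½
  ½-pos = ⁻¹-pos (<⇒≢′ 0<2) 0<2

  ½+½≡1 : ½ + ½ ≡ 1#
  ½+½≡1 = trans (cong₂ _+_ (sym (*-idˡ ½)) (sym (*-idˡ ½)))
                (trans (sym (distribʳ ½ 1# 1#)) (*-inverseʳ (1# + 1#) (<⇒≢′ 0<2)))

  x+x≡0⇒x≡0 : ∀ {x} → x + x ≡ 0# → x ≡ 0#
  x+x≡0⇒x≡0 {x} x+x≡0 = integralˡ (<⇒≢′ 0<2)
    (trans (distribʳ x 1# 1#) (trans (cong₂ _+_ (*-idˡ x) (*-idˡ x)) x+x≡0))

  fromℕ : ℕ → Carrier
  fromℕ ℕ.zero = 0#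
  fromℕ (ℕ.suc n) = 1# + fromℕ n

  fromℕ-+ : ∀ m n → fromℕ (m ℕ.+ n) ≡ fromℕ m + fromℕ n
  fromℕ-+ ℕ.zero n = sym (+-idˡ (fromℕ n))
  fromℕ-+ (ℕ.suc m) n = trans (cong (1# +_) (fromℕ-+ m n)) (sym (+-assoc 1# (fromℕ m) (fromℕ n)))

  fromℕ-* : ∀ m n → fromℕ (m ℕ.* n) ≡ fromℕ m * fromℕ n
  fromℕ-* ℕ.zero n = sym (zeroˡ (fromℕ n))
  fromℕ-* (ℕ.suc m) n = begin
    fromℕ (n ℕ.+ m ℕ.* n)          ≡⟨ fromℕ-+ n (m ℕ.* n) ⟩
    fromℕ n + fromℕ (m ℕ.* n)      ≡⟨ cong₂ _+_ (sym (*-idˡ (fromℕ n))) (fromℕ-* m n) ⟩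
    1# * fromℕ n + fromℕ m * fromℕ n ≡⟨ sym (distribʳ (fromℕ n) 1# (fromℕ m)) ⟩
    (1# + fromℕ m) * fromℕ n       ∎
    where open ≡-Reasoning

  fromℕ-nonneg : ∀ n → 0# ≤ fromℕ n
  fromℕ-nonneg ℕ.zero = inj₂ refl
  fromℕ-nonneg (ℕ.suc n) = inj₁ (+-pos-nonneg 0<1 (fromℕ-nonneg n))

  fromℕ-mono-< : ∀ {m n} → m ℕ.< n → fromℕ m < fromℕ n
  fromℕ-mono-< {m} {n} m<n = 0<y-x⇒x<y (subst (0# <_) (sym n-m≡1+k) (+-pos-nonneg 0<1 (fromℕ-nonneg k)))
    where
    open ≡-Reasoning
    k : ℕ
    k = n ℕ.∸ ℕ.suc m
    n≡k+1+m : n ≡ k ℕ.+ ℕ.suc m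
    n≡k+1+m = sym (ℕₚ.m∸n+n≡m m<n)
    n-m≡1+k : fromℕ n + - fromℕ m ≡ 1# + fromℕ k
    n-m≡1+k = begin
      fromℕ n + - fromℕ m                          ≡⟨ cong (λ l → fromℕ l + - fromℕ m) n≡k+1+m ⟩
      fromℕ (k ℕ.+ ℕ.suc m) + - fromℕ m            ≡⟨ cong (_+ - fromℕ m) (fromℕ-+ k (ℕ.suc m)) ⟩
      fromℕ k + (1# + fromℕ m) + - fromℕ m          ≡⟨ +-assoc _ _ _ ⟩
      fromℕ k + ((1# + fromℕ m) + - fromℕ m)        ≡⟨ cong (fromℕ k +_) (+-assoc _ _ _) ⟩
      fromℕ k + (1# + (fromℕ m + - fromℕ m))        ≡⟨ cong (λ u → fromℕ k + (1# + u)) (-‿inverseʳ _) ⟩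
      fromℕ k + (1# + 0#)                          ≡⟨ cong (fromℕ k +_) (+-identityʳ 1#) ⟩
      fromℕ k + 1#                                 ≡⟨ +-comm _ _ ⟩
      1# + fromℕ k                                 ∎

  signed : Bool → Carrier → Carrier
  signed true x = x
  signed false x = - x

  signed-involutive : ∀ s x → signed s (signed s x) ≡ x
  signed-involutive true x = refl
  signed-involutive false x = -‿involutive x

  signed-zero : ∀ s → signed s 0# ≡ 0#
  signed-zero true = refl
  signed-zero false = -0#≈0#

  signed-*ʳ : ∀ s x y → x * signed s y ≡ signed s (x * y)
  signed-*ʳ true x y = refl
  signed-*ʳ false x y = sym (-‿distribʳ-* x y)

  signed-not : ∀ s x y → signed s x * signed (not s) y ≡ - (x * y)
  signed-not true x y = sym (-‿distribʳ-* x y)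
  signed-not false x y = sym (-‿distribˡ-* x y)

  signed-same : ∀ s x y → signed s x * signed s y ≡ x * y
  signed-same true x y = refl
  signed-same false x y = -x*-y≡x*y x y

  signed-signed : ∀ s t x → signed s (signed t x) ≡ x ⊎ signed s (signed t x) ≡ - x
  signed-signed true true x = inj₁ refl
  signed-signed true false x = inj₂ refl
  signed-signed false true x = inj₂ refl
  signed-signed false false x = inj₁ (-‿involutive x)

  signed-signed-≢ : ∀ s t x → t ≢ s → signed s (signed t x) ≡ - x
  signed-signed-≢ true true x t≢s = ⊥-elim (t≢s refl)
  signed-signed-≢ true false x _ = refl
  signed-signed-≢ false true x _ = refl
  signed-signed-≢ false false x t≢s = ⊥-elim (t≢s refl)

  indicator : Bool → Carrier
  indicator true = 1#
  indicator false = 0#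

-- Integer coefficients, whose equality the solver can decide.
module FieldSolver (R : RealField) where
  open OrderedFieldProperties R

  private
    withSign : Sign → Carrier → Carrier
    withSign Sign.+ x = x
    withSign Sign.- x = - x

    withSign-* : ∀ s t x y → withSign (s Sign.* t) (x * y) ≡ withSign s x * withSign t y
    withSign-* Sign.+ Sign.+ x y = refl
    withSign-* Sign.+ Sign.- x y = -‿distribʳ-* x y
    withSign-* Sign.- Sign.+ x y = -‿distribˡ-* x y
    withSign-* Sign.- Sign.- x y = sym (-x*-y≡x*y x y)

  fromℤ : ℤ → Carrier
  fromℤ (pos n) = fromℕ n
  fromℤ (negsuc n) = - fromℕ (ℕ.suc n)

  private
    fromℤ-◃ : ∀ s n → fromℤ (s ℤ.◃ n) ≡ withSign s (fromℕ n)
    fromℤ-◃ Sign.+ ℕ.zero = refl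
    fromℤ-◃ Sign.- ℕ.zero = sym -0#≈0#
    fromℤ-◃ Sign.+ (ℕ.suc n) = refl
    fromℤ-◃ Sign.- (ℕ.suc n) = refl

    fromℤ-signAbs : ∀ i → fromℤ i ≡ withSign (ℤ.sign i) (fromℕ ℤ.∣ i ∣)
    fromℤ-signAbs (pos n) = refl
    fromℤ-signAbs (negsuc n) = refl

    fromℤ-* : ∀ i j → fromℤ (i ℤ.* j) ≡ fromℤ i * fromℤ j
    fromℤ-* i j = begin
      fromℤ (i ℤ.* j)                                            ≡⟨ fromℤ-◃ (s Sign.* t) (ℤ.∣ i ∣ ℕ.* ℤ.∣ j ∣) ⟩
      withSign (s Sign.* t) (fromℕ (ℤ.∣ i ∣ ℕ.* ℤ.∣ j ∣))         ≡⟨ cong (withSign (s Sign.* t)) (fromℕ-* ℤ.∣ i ∣ ℤ.∣ j ∣) ⟩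
      withSign (s Sign.* t) (fromℕ ℤ.∣ i ∣ * fromℕ ℤ.∣ j ∣)       ≡⟨ withSign-* s t _ _ ⟩
      withSign s (fromℕ ℤ.∣ i ∣) * withSign t (fromℕ ℤ.∣ j ∣)       ≡⟨ sym (cong₂ _*_ (fromℤ-signAbs i) (fromℤ-signAbs j)) ⟩
      fromℤ i * fromℤ j                                          ∎
      where
      open ≡-Reasoning
      s t : Sign
      s = ℤ.sign i
      t = ℤ.sign j

    a+b-[a+c]≡b-c : ∀ a b c → a + b + - (a + c) ≡ b + - c
    a+b-[a+c]≡b-c a b c = begin
      a + b + - (a + c)        ≡⟨ cong (a + b +_) (-‿anti-homo-+ a c) ⟩
      a + b + (- c + - a)      ≡⟨ +-assoc a b _ ⟩
      a + (b + (- c + - a))    ≡⟨ cong (a +_) (trans (sym (+-assoc b (- c) (- a))) (+-comm (b + - c) (- a))) ⟩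
      a + (- a + (b + - c))    ≡⟨ sym (+-assoc a (- a) _) ⟩
      a + - a + (b + - c)      ≡⟨ cong (_+ (b + - c)) (-‿inverseʳ a) ⟩
      0# + (b + - c)           ≡⟨ +-idˡ _ ⟩
      b + - c                  ∎
      where open ≡-Reasoning

    fromℤ-⊖ : ∀ m n → fromℤ (m ℤ.⊖ n) ≡ fromℕ m + - fromℕ n
    fromℤ-⊖ ℕ.zero ℕ.zero = sym (trans (+-idˡ (- 0#)) -0#≈0#)
    fromℤ-⊖ ℕ.zero (ℕ.suc n) = sym (+-idˡ _)
    fromℤ-⊖ (ℕ.suc m) ℕ.zero = sym (trans (cong (fromℕ (ℕ.suc m) +_) -0#≈0#) (+-identityʳ _))
    fromℤ-⊖ (ℕ.suc m) (ℕ.suc n) =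
      trans (cong fromℤ (ℤₚ.[1+m]⊖[1+n]≡m⊖n m n)) (trans (fromℤ-⊖ m n) (sym (a+b-[a+c]≡b-c 1# (fromℕ m) (fromℕ n))))

    fromℤ-+ : ∀ i j → fromℤ (i ℤ.+ j) ≡ fromℤ i + fromℤ j
    fromℤ-+ (pos m) (pos n) = fromℕ-+ m n
    fromℤ-+ (pos m) (negsuc n) = fromℤ-⊖ m (ℕ.suc n)
    fromℤ-+ (negsuc m) (pos n) = trans (fromℤ-⊖ n (ℕ.suc m)) (+-comm _ _)
    fromℤ-+ (negsuc m) (negsuc n) = begin
      - fromℕ (ℕ.suc (ℕ.suc (m ℕ.+ n)))                    ≡⟨ cong (λ x → - (1# + x)) (fromℕ-+ (ℕ.suc m) n) ⟩
      - (1# + (fromℕ (ℕ.suc m) + fromℕ n))                 ≡⟨ cong -_ (trans (sym (+-assoc _ _ _)) (cong (_+ fromℕ n) (+-comm 1# _))) ⟩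
      - (fromℕ (ℕ.suc m) + 1# + fromℕ n)                   ≡⟨ cong -_ (+-assoc _ _ _) ⟩
      - (fromℕ (ℕ.suc m) + fromℕ (ℕ.suc n))                ≡⟨ -‿anti-homo-+ _ _ ⟩
      - fromℕ (ℕ.suc n) + - fromℕ (ℕ.suc m)                ≡⟨ +-comm _ _ ⟩
      - fromℕ (ℕ.suc m) + - fromℕ (ℕ.suc n)                ∎
      where open ≡-Reasoning

    fromℤ-- : ∀ i → fromℤ (ℤ.- i) ≡ - fromℤ i
    fromℤ-- (pos ℕ.zero) = sym -0#≈0#
    fromℤ-- (pos (ℕ.suc n)) = refl
    fromℤ-- (negsuc n) = sym (-‿involutive _)

    fromℤ-homomorphism : ℤ.+-*-rawRing -Raw-AlmostCommutative⟶ fromCommutativeRing commutativeRing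
    fromℤ-homomorphism = record
      { ⟦_⟧ = fromℤ ; +-homo = fromℤ-+ ; *-homo = fromℤ-* ; -‿homo = fromℤ--
      ; 0-homo = refl ; 1-homo = +-identityʳ 1# }

    fromℤ-≟ : ∀ i j → Maybe (fromℤ i ≡ fromℤ j)
    fromℤ-≟ i j with i ℤ.≟ j
    ... | yes refl = just refl
    ... | no _ = nothing

  open import Algebra.Solver.Ring ℤ.+-*-rawRing (fromCommutativeRing commutativeRing) fromℤ-homomorphism fromℤ-≟ public
    using (solve; _:=_; _:+_; _:*_; :-_)

module FinSubsets where

  true≢false : true ≢ false
  true≢false ()

  count : ∀ {n} → (Fin n → Bool) → ℕ
  count {ℕ.zero} B = 0
  count {ℕ.suc n} B = (if B zero then 1 else 0) ℕ.+ count (B ∘ suc)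

  count-cong : ∀ {n} {B C : Fin n → Bool} → (∀ i → B i ≡ C i) → count B ≡ count C
  count-cong {ℕ.zero} B≗C = refl
  count-cong {ℕ.suc n} B≗C =
    cong₂ (λ b c → (if b then 1 else 0) ℕ.+ c) (B≗C zero) (count-cong (B≗C ∘ suc))

  count-all : ∀ n → count {n} (λ _ → true) ≡ n
  count-all ℕ.zero = refl
  count-all (ℕ.suc n) = cong ℕ.suc (count-all n)

  count-pos : ∀ {n} (B : Fin n → Bool) → 0 ℕ.< count B → ∃ λ j → B j ≡ true
  count-pos {ℕ.suc n} B 0<count with B zero in B0
  ... | true = zero , B0
  ... | false with count-pos (B ∘ suc) 0<count
  ...   | j , Bj = suc j , Bj

  erase : ∀ {n} → (Fin n → Bool) → Fin n → Fin n → Bool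
  erase B a i with i Fin.≟ a
  ... | yes _ = false
  ... | no _ = B i

  erase-self : ∀ {n} (B : Fin n → Bool) a → erase B a a ≡ false
  erase-self B a with a Fin.≟ a
  ... | yes _ = refl
  ... | no a≢a = ⊥-elim (a≢a refl)

  erase-other : ∀ {n} (B : Fin n → Bool) a i → i ≢ a → erase B a i ≡ B i
  erase-other B a i i≢a with i Fin.≟ a
  ... | yes i≡a = ⊥-elim (i≢a i≡a)
  ... | no _ = refl

  erase-true : ∀ {n} (B : Fin n → Bool) a i → erase B a i ≡ true → B i ≡ true × i ≢ a
  erase-true B a i e with i Fin.≟ a
  erase-true B a i () | yes _
  ... | no i≢a = e , i≢a

  erase-suc : ∀ {n} (B : Fin (ℕ.suc n) → Bool) a i → erase B (suc a) (suc i) ≡ erase (B ∘ suc) a i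
  erase-suc B a i = by-cases (i Fin.≟ a)
    where
    by-cases : Dec (i ≡ a) → erase B (suc a) (suc i) ≡ erase (B ∘ suc) a i
    by-cases (yes refl) = trans (erase-self B (suc a)) (sym (erase-self (B ∘ suc) a))
    by-cases (no i≢a) = trans (erase-other B (suc a) (suc i) (i≢a ∘ Finₚ.suc-injective))
                              (sym (erase-other (B ∘ suc) a i i≢a))

  count-erase : ∀ {n} (B : Fin n → Bool) a → B a ≡ true → ℕ.suc (count (erase B a)) ≡ count B
  count-erase B zero B0 rewrite erase-self B zero | B0 =
    cong ℕ.suc (count-cong (λ i → erase-other B zero (suc i) (λ ())))
  count-erase B (suc a) Ba rewrite erase-other B (suc a) zero (λ ()) = begin
    ℕ.suc (b ℕ.+ count (λ i → erase B (suc a) (suc i)))  ≡⟨ cong (λ c → ℕ.suc (b ℕ.+ c)) (count-cong (erase-suc B a)) ⟩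
    ℕ.suc (b ℕ.+ count (erase (B ∘ suc) a))              ≡⟨ sym (ℕₚ.+-suc b _) ⟩
    b ℕ.+ ℕ.suc (count (erase (B ∘ suc) a))              ≡⟨ cong (b ℕ.+_) (count-erase (B ∘ suc) a Ba) ⟩
    b ℕ.+ count (B ∘ suc)                                ∎
    where
    open ≡-Reasoning
    b : ℕ
    b = if B zero then 1 else 0

  StrictlyIncreasing : ∀ {m n} → (Fin m → Fin n) → Set
  StrictlyIncreasing k = ∀ a b → toℕ a ℕ.< toℕ b → toℕ (k a) ℕ.< toℕ (k b)

  increasing⇒injective : ∀ {m n} {k : Fin m → Fin n} → StrictlyIncreasing k → ∀ a b → k a ≡ k b → a ≡ b
  increasing⇒injective {k = k} k↑ a b ka≡kb with ℕₚ.<-cmp (toℕ a) (toℕ b)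
  ... | tri< a<b _ _ = ⊥-elim (ℕₚ.<-irrefl (cong toℕ ka≡kb) (k↑ a b a<b))
  ... | tri≈ _ a≡b _ = Finₚ.toℕ-injective a≡b
  ... | tri> _ _ b<a = ⊥-elim (ℕₚ.<-irrefl (cong toℕ (sym ka≡kb)) (k↑ b a b<a))

  record Enumeration {n} (B : Fin n → Bool) (m : ℕ) : Set where
    field
      index      : Fin m → Fin n
      increasing : StrictlyIncreasing index
      complete   : ∀ j → B j ≡ true → ∃ λ a → index a ≡ j
      sound      : ∀ a → B (index a) ≡ true

  enumerate : ∀ {n} (B : Fin n → Bool) → Enumeration B (count B)
  enumerate {ℕ.zero} B = record { index = λ () ; increasing = λ () ; complete = λ () ; sound = λ () }
  enumerate {ℕ.suc n} B with B zero in B0 | enumerate (B ∘ suc)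
  ... | false | E = record
    { index = suc ∘ index
    ; increasing = λ a b a<b → ℕ.s≤s (increasing a b a<b)
    ; complete = λ { zero Bj → ⊥-elim (true≢false (trans (sym Bj) B0))
                   ; (suc j) Bj → let a , ia≡j = complete j Bj in a , cong suc ia≡j }
    ; sound = sound }
    where
    open Enumeration E
  ... | true | E = record { index = index′ ; increasing = increasing′ ; complete = complete′ ; sound = sound′ }
    where
    open Enumeration E
    index′ : Fin (ℕ.suc (count (B ∘ suc))) → Fin (ℕ.suc n)
    index′ zero = zero
    index′ (suc a) = suc (index a)
    increasing′ : StrictlyIncreasing index′
    increasing′ zero (suc b) _ = ℕ.s≤s ℕ.z≤n
    increasing′ (suc a) (suc b) (ℕ.s≤s a<b) = ℕ.s≤s (increasing a b a<b)
    complete′ : ∀ j → B j ≡ true → ∃ λ a → index′ a ≡ j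
    complete′ zero _ = zero , refl
    complete′ (suc j) Bj = let a , ia≡j = complete j Bj in suc a , cong suc ia≡j
    sound′ : ∀ a → B (index′ a) ≡ true
    sound′ zero = B0
    sound′ (suc a) = sound a

  ascend-from-zero : ∀ {d} (P : Fin (ℕ.suc d) → Set) →
    (∀ (a : Fin d) → P (Fin.inject₁ a) → P (suc a)) → P zero → ∀ a → P a
  ascend-from-zero P step P0 zero = P0
  ascend-from-zero {ℕ.suc d} P step P0 (suc a) = ascend-from-zero (P ∘ suc) (step ∘ suc) (step zero P0) a

  descend-to-zero : ∀ {d} (P : Fin (ℕ.suc d) → Set) →
    (∀ (a : Fin d) → P (suc a) → P (Fin.inject₁ a)) → ∀ a → P a → P zero
  descend-to-zero P step zero Pa = Pa
  descend-to-zero {ℕ.suc d} P step (suc a) Pa = descend-to-zero (P ∘ Fin.inject₁) (step ∘ Fin.inject₁) a (step a Pa)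

  outside-adjacent : ∀ {d} (a : Fin d) (l : Fin (ℕ.suc d)) → l ≢ Fin.inject₁ a → l ≢ suc a →
                     toℕ l ℕ.< toℕ a ⊎ ℕ.suc (toℕ a) ℕ.< toℕ l
  outside-adjacent a l l≢a l≢a+1 with ℕₚ.<-cmp (toℕ l) (toℕ a)
  ... | tri< l<a _ _ = inj₁ l<a
  ... | tri≈ _ l≡a _ = ⊥-elim (l≢a (Finₚ.toℕ-injective (trans l≡a (sym (Finₚ.toℕ-inject₁ a)))))
  ... | tri> _ _ a<l with ℕₚ.m≤n⇒m<n∨m≡n a<l
  ...   | inj₁ a+1<l = inj₂ a+1<l
  ...   | inj₂ a+1≡l = ⊥-elim (l≢a+1 (Finₚ.toℕ-injective (sym a+1≡l)))

module FiniteSums (R : RealField) where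
  open OrderedFieldProperties R
  open FieldSolver R
  open Geometry R using (sumF; sum2)

  sumF-cong : ∀ {n} {f g : Fin n → Carrier} → (∀ i → f i ≡ g i) → sumF f ≡ sumF g
  sumF-cong {ℕ.zero} f≗g = refl
  sumF-cong {ℕ.suc n} f≗g = cong₂ _+_ (f≗g zero) (sumF-cong (λ i → f≗g (suc i)))

  sumF-zero : ∀ {n} {f : Fin n → Carrier} → (∀ i → f i ≡ 0#) → sumF f ≡ 0#
  sumF-zero {ℕ.zero} f≗0 = refl
  sumF-zero {ℕ.suc n} f≗0 = trans (cong₂ _+_ (f≗0 zero) (sumF-zero (λ i → f≗0 (suc i)))) (+-idˡ 0#)

  sumF-distrib-+ : ∀ {n} (f g : Fin n → Carrier) → sumF (λ i → f i + g i) ≡ sumF f + sumF g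
  sumF-distrib-+ {ℕ.zero} f g = sym (+-idˡ 0#)
  sumF-distrib-+ {ℕ.suc n} f g =
    trans (cong (f zero + g zero +_) (sumF-distrib-+ (λ i → f (suc i)) (λ i → g (suc i)))) (medial _ _ _ _)
    where
    medial : ∀ a b c e → a + b + (c + e) ≡ a + c + (b + e)
    medial = solve 4 (λ a b c e → a :+ b :+ (c :+ e) := a :+ c :+ (b :+ e)) refl

  sumF-*ˡ : ∀ {n} a (f : Fin n → Carrier) → sumF (λ i → a * f i) ≡ a * sumF f
  sumF-*ˡ {ℕ.zero} a f = sym (zeroʳ a)
  sumF-*ˡ {ℕ.suc n} a f = trans (cong (a * f zero +_) (sumF-*ˡ a (λ i → f (suc i)))) (sym (distribˡ a _ _))

  sumF-neg : ∀ {n} (f : Fin n → Carrier) → sumF (λ i → - f i) ≡ - sumF f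
  sumF-neg {ℕ.zero} f = sym -0#≈0#
  sumF-neg {ℕ.suc n} f =
    trans (cong (- f zero +_) (sumF-neg (λ i → f (suc i)))) (sym (trans (-‿anti-homo-+ _ _) (+-comm _ _)))

  sumF-split : ∀ {n} (f g : Fin n → Carrier) a → g a ≡ 0# → (∀ i → i ≢ a → g i ≡ f i) →
               sumF f ≡ f a + sumF g
  sumF-split f g zero ga≡0 g≗f =
    cong (f zero +_) (trans (sumF-cong (λ i → sym (g≗f (suc i) (λ ()))))
                            (sym (trans (cong (_+ sumF (λ i → g (suc i))) ga≡0) (+-idˡ _))))
  sumF-split f g (suc a) ga≡0 g≗f = begin
    f zero + sumF (λ i → f (suc i))                ≡⟨ cong (f zero +_) (sumF-split _ _ a ga≡0 (λ i i≢a → g≗f (suc i) (i≢a ∘ Finₚ.suc-injective))) ⟩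
    f zero + (f (suc a) + sumF (λ i → g (suc i)))  ≡⟨ swap (f zero) (f (suc a)) _ ⟩
    f (suc a) + (f zero + sumF (λ i → g (suc i)))  ≡⟨ cong (λ x → f (suc a) + (x + _)) (sym (g≗f zero (λ ()))) ⟩
    f (suc a) + sumF g                             ∎
    where
    open ≡-Reasoning
    swap : ∀ a b c → a + (b + c) ≡ b + (a + c)
    swap = solve 3 (λ a b c → a :+ (b :+ c) := b :+ (a :+ c)) refl

  _without_ : ∀ {n} → (Fin n → Carrier) → Fin n → Fin n → Carrier
  (f without a) i with i Fin.≟ a
  ... | yes _ = 0#
  ... | no _ = f i

  without-self : ∀ {n} (f : Fin n → Carrier) a → (f without a) a ≡ 0#
  without-self f a with a Fin.≟ a
  ... | yes _ = refl
  ... | no a≢a = ⊥-elim (a≢a refl)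

  without-other : ∀ {n} (f : Fin n → Carrier) a i → i ≢ a → (f without a) i ≡ f i
  without-other f a i i≢a with i Fin.≟ a
  ... | yes i≡a = ⊥-elim (i≢a i≡a)
  ... | no _ = refl

  sumF-without : ∀ {n} (f : Fin n → Carrier) a → sumF f ≡ f a + sumF (f without a)
  sumF-without f a = sumF-split f (f without a) a (without-self f a) (without-other f a)

  sumF-single : ∀ {n} (f : Fin n → Carrier) a → (∀ i → i ≢ a → f i ≡ 0#) → sumF f ≡ f a
  sumF-single {n} f a f≗0 = begin
    sumF f                     ≡⟨ sumF-split f (λ _ → 0#) a refl (λ i i≢a → sym (f≗0 i i≢a)) ⟩
    f a + sumF {n} (λ _ → 0#)  ≡⟨ cong (f a +_) (sumF-zero {n} (λ _ → refl)) ⟩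
    f a + 0#                   ≡⟨ +-identityʳ _ ⟩
    f a                        ∎
    where open ≡-Reasoning

  sumF-two : ∀ {n} (f : Fin n → Carrier) a b → a ≢ b → (∀ i → i ≢ a → i ≢ b → f i ≡ 0#) →
             sumF f ≡ f a + f b
  sumF-two f a b a≢b f≗0 =
    trans (sumF-without f a)
          (cong (f a +_) (trans (sumF-single (f without a) b rest≗0) (without-other f a b (a≢b ∘ sym))))
    where
    rest≗0 : ∀ i → i ≢ b → (f without a) i ≡ 0#
    rest≗0 i i≢b with i Fin.≟ a
    ... | yes _ = refl
    ... | no i≢a = f≗0 i i≢a i≢b

  sumF-nonneg : ∀ {n} (f : Fin n → Carrier) → (∀ i → 0# ≤ f i) → 0# ≤ sumF f
  sumF-nonneg {ℕ.zero} f 0≤f = inj₂ refl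
  sumF-nonneg {ℕ.suc n} f 0≤f = +-nonneg (0≤f zero) (sumF-nonneg _ (λ i → 0≤f (suc i)))

  sumF-pos : ∀ {n} (f : Fin n → Carrier) a → (∀ i → 0# ≤ f i) → 0# < f a → 0# < sumF f
  sumF-pos f a 0≤f 0<fa = subst (0# <_) (sym (sumF-without f a)) (+-pos-nonneg 0<fa (sumF-nonneg _ 0≤rest))
    where
    0≤rest : ∀ i → 0# ≤ (f without a) i
    0≤rest i with i Fin.≟ a
    ... | yes _ = inj₂ refl
    ... | no _ = 0≤f i

  sumF-≢0 : ∀ {n} (f : Fin n → Carrier) → sumF f ≢ 0# → ∃ λ i → f i ≢ 0#
  sumF-≢0 {ℕ.zero} f Σ≢0 = ⊥-elim (Σ≢0 refl)
  sumF-≢0 {ℕ.suc n} f Σ≢0 with f zero ≟0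
  ... | no f0≢0 = zero , f0≢0
  ... | yes f0≡0 with sumF-≢0 (λ i → f (suc i)) (λ Σ≡0 → Σ≢0 (trans (cong₂ _+_ f0≡0 Σ≡0) (+-idˡ 0#)))
  ...   | i , fi≢0 = suc i , fi≢0

  sumF-reindex : ∀ {m n} (k : Fin m → Fin n) → (∀ a b → k a ≡ k b → a ≡ b) →
                 (f : Fin n → Carrier) → (∀ i → (∀ b → k b ≢ i) → f i ≡ 0#) →
                 sumF f ≡ sumF (λ b → f (k b))
  sumF-reindex {ℕ.zero} k k-inj f f≗0 = sumF-zero (λ i → f≗0 i (λ ()))
  sumF-reindex {ℕ.suc m} k k-inj f f≗0 =
    trans (sumF-without f (k zero))
      (cong (f (k zero) +_)
        (trans (sumF-reindex (k ∘ suc) (λ a b e → Finₚ.suc-injective (k-inj _ _ e)) (f without k zero) rest≗0)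
               (sumF-cong (λ b → without-other f (k zero) (k (suc b)) (λ e → Finₚ.0≢1+n (k-inj _ _ (sym e)))))))
    where
    rest≗0 : ∀ i → (∀ b → k (suc b) ≢ i) → (f without k zero) i ≡ 0#
    rest≗0 i i∉k with i Fin.≟ k zero
    ... | yes _ = refl
    ... | no i≢k0 = f≗0 i λ { zero e → i≢k0 (sym e) ; (suc b) e → i∉k b e }

  delta : ∀ {n} → Fin n → Carrier → Fin n → Carrier
  delta j c i with i Fin.≟ j
  ... | yes _ = c
  ... | no _ = 0#

  delta-same : ∀ {n} (j : Fin n) c → delta j c j ≡ c
  delta-same j c with j Fin.≟ j
  ... | yes _ = refl
  ... | no j≢j = ⊥-elim (j≢j refl)

  delta-other : ∀ {n} (j : Fin n) c i → i ≢ j → delta j c i ≡ 0#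
  delta-other j c i i≢j with i Fin.≟ j
  ... | yes i≡j = ⊥-elim (i≢j i≡j)
  ... | no _ = refl

  sumF-*delta : ∀ {n} (f : Fin n → Carrier) j c → sumF (λ i → f i * delta j c i) ≡ f j * c
  sumF-*delta f j c =
    trans (sumF-single _ j (λ i i≢j → trans (cong (f i *_) (delta-other j c i i≢j)) (zeroʳ _)))
          (cong (f j *_) (delta-same j c))

  prodF : ∀ {n} → (Fin n → Carrier) → Carrier
  prodF {ℕ.zero} f = 1#
  prodF {ℕ.suc n} f = f zero * prodF (λ i → f (suc i))

  prodF-zero : ∀ {n} (f : Fin n → Carrier) a → f a ≡ 0# → prodF f ≡ 0#
  prodF-zero f zero fa≡0 = trans (cong (_* prodF (λ i → f (suc i))) fa≡0) (zeroˡ _)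
  prodF-zero f (suc a) fa≡0 = trans (cong (f zero *_) (prodF-zero (λ i → f (suc i)) a fa≡0)) (zeroʳ _)

  prodF-≢0 : ∀ {n} (f : Fin n → Carrier) → (∀ a → f a ≢ 0#) → prodF f ≢ 0#
  prodF-≢0 {ℕ.zero} f f≢0 = 0≢1 ∘ sym
  prodF-≢0 {ℕ.suc n} f f≢0 = *-≢0 (f≢0 zero) (prodF-≢0 (λ i → f (suc i)) (λ i → f≢0 (suc i)))

  prodF-pos : ∀ {n} (f : Fin n → Carrier) → (∀ a → 0# < f a) → 0# < prodF f
  prodF-pos {ℕ.zero} f 0<f = 0<1
  prodF-pos {ℕ.suc n} f 0<f = *-pos (0<f zero) (prodF-pos (λ i → f (suc i)) (λ i → 0<f (suc i)))

  prodF-* : ∀ {n} (f g : Fin n → Carrier) → prodF f * prodF g ≡ prodF (λ i → f i * g i)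
  prodF-* {ℕ.zero} f g = *-idˡ 1#
  prodF-* {ℕ.suc n} f g =
    trans (medial (f zero) (prodF (λ i → f (suc i))) (g zero) (prodF (λ i → g (suc i))))
          (cong (f zero * g zero *_) (prodF-* (λ i → f (suc i)) (λ i → g (suc i))))
    where
    medial : ∀ a b c e → a * b * (c * e) ≡ a * c * (b * e)
    medial = solve 4 (λ a b c e → a :* b :* (c :* e) := a :* c :* (b :* e)) refl

  sum2-cong : ∀ {n} {f g : Fin n → Bool → Carrier} → (∀ j t → f j t ≡ g j t) → sum2 f ≡ sum2 g
  sum2-cong f≗g = sumF-cong (λ j → cong₂ _+_ (f≗g j true) (f≗g j false))

  sum2-distrib-+ : ∀ {n} (f g : Fin n → Bool → Carrier) → sum2 (λ j t → f j t + g j t) ≡ sum2 f + sum2 g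
  sum2-distrib-+ f g = trans (sumF-cong (λ j → medial (f j true) (g j true) (f j false) (g j false)))
                             (sumF-distrib-+ (λ j → f j true + f j false) (λ j → g j true + g j false))
    where
    medial : ∀ a b c e → a + b + (c + e) ≡ a + c + (b + e)
    medial = solve 4 (λ a b c e → a :+ b :+ (c :+ e) := a :+ c :+ (b :+ e)) refl

  sum2-*ˡ : ∀ {n} a (f : Fin n → Bool → Carrier) → sum2 (λ j t → a * f j t) ≡ a * sum2 f
  sum2-*ˡ a f = trans (sumF-cong (λ j → sym (distribˡ a (f j true) (f j false)))) (sumF-*ˡ a (λ j → f j true + f j false))

  sum2-neg : ∀ {n} (f : Fin n → Bool → Carrier) → sum2 (λ j t → - f j t) ≡ - sum2 f
  sum2-neg f = trans (sumF-cong (λ j → trans (+-comm _ _) (sym (-‿anti-homo-+ (f j true) (f j false)))))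
                     (sumF-neg (λ j → f j true + f j false))

  sum2-difference : ∀ {n} (f g : Fin n → Bool → Carrier) → sum2 (λ j t → f j t + - g j t) ≡ sum2 f + - sum2 g
  sum2-difference f g = trans (sum2-distrib-+ f (λ j t → - g j t)) (cong (sum2 f +_) (sum2-neg g))

  sum2-signed : ∀ {n} s (f : Fin n → Bool → Carrier) → signed s (sum2 f) ≡ sum2 (λ j t → signed s (f j t))
  sum2-signed true f = refl
  sum2-signed false f = sym (sum2-neg f)

  sum2-≢0 : ∀ {n} (f : Fin n → Bool → Carrier) → sum2 f ≢ 0# → ∃ λ j → ∃ λ t → f j t ≢ 0#
  sum2-≢0 f Σ≢0 with sumF-≢0 (λ j → f j true + f j false) Σ≢0
  ... | j , fj≢0 with f j true ≟0
  ...   | no fjt≢0 = j , true , fjt≢0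
  ...   | yes fjt≡0 = j , false , λ fjf≡0 → fj≢0 (trans (cong₂ _+_ fjt≡0 fjf≡0) (+-idˡ 0#))

  sum2-pos : ∀ {n} (f : Fin n → Bool → Carrier) j t → (∀ j t → 0# ≤ f j t) → 0# < f j t → 0# < sum2 f
  sum2-pos f j t 0≤f 0<fjt =
    sumF-pos (λ j → f j true + f j false) j (λ j → +-nonneg (0≤f j true) (0≤f j false)) (pair-pos t 0<fjt)
    where
    pair-pos : ∀ t → 0# < f j t → 0# < f j true + f j false
    pair-pos true 0<fjt = +-pos-nonneg 0<fjt (0≤f j false)
    pair-pos false 0<fjf = subst (0# <_) (+-comm _ _) (+-pos-nonneg 0<fjf (0≤f j true))

  sum2-convex-< : ∀ {n} (μ f : Fin n → Bool → Carrier) m → (∀ j t → 0# ≤ μ j t) → sum2 μ ≡ 1# →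
                  (∀ j t → μ j t ≢ 0# → f j t < m) → sum2 (λ j t → μ j t * f j t) < m
  sum2-convex-< μ f m 0≤μ Σμ≡1 f<m with sum2-≢0 μ (λ Σμ≡0 → 0≢1 (trans (sym Σμ≡0) Σμ≡1))
  ... | j , t , μjt≢0 = 0<y-x⇒x<y (subst (0# <_) gap-sum (sum2-pos gap j t 0≤gap (0<gap j t μjt≢0)))
    where
    open ≡-Reasoning
    gap : Fin _ → Bool → Carrier
    gap j t = μ j t * (m + - f j t)
    0<gap : ∀ j t → μ j t ≢ 0# → 0# < gap j t
    0<gap j t μjt≢0 with 0≤μ j t
    ... | inj₁ 0<μjt = *-pos 0<μjt (x<y⇒0<y-x (f<m j t μjt≢0))
    ... | inj₂ 0≡μjt = ⊥-elim (μjt≢0 (sym 0≡μjt))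
    0≤gap : ∀ j t → 0# ≤ gap j t
    0≤gap j t with μ j t ≟0
    ... | yes μjt≡0 = inj₂ (sym (trans (cong (_* _) μjt≡0) (zeroˡ _)))
    ... | no μjt≢0 = inj₁ (0<gap j t μjt≢0)
    gap-sum : sum2 gap ≡ m + - sum2 (λ j t → μ j t * f j t)
    gap-sum = begin
      sum2 gap
        ≡⟨ sum2-cong (λ j t → trans (distribˡ (μ j t) m (- f j t)) (cong₂ _+_ (*-comm (μ j t) m) (sym (-‿distribʳ-* _ _)))) ⟩
      sum2 (λ j t → m * μ j t + - (μ j t * f j t))
        ≡⟨ sum2-distrib-+ (λ j t → m * μ j t) (λ j t → - (μ j t * f j t)) ⟩
      sum2 (λ j t → m * μ j t) + sum2 (λ j t → - (μ j t * f j t))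
        ≡⟨ cong₂ _+_ (trans (sum2-*ˡ m μ) (trans (cong (m *_) Σμ≡1) (*-identityʳ m))) (sum2-neg (λ j t → μ j t * f j t)) ⟩
      m + - sum2 (λ j t → μ j t * f j t) ∎

  pushforward : ∀ {m n} → (Fin m → Fin n) → (Fin m → Carrier) → Fin n → Carrier
  pushforward k f j with Finₚ.any? (λ a → k a Fin.≟ j)
  ... | yes (a , _) = f a
  ... | no _ = 0#

  pushforward-image : ∀ {m n} {k : Fin m → Fin n} → (∀ a b → k a ≡ k b → a ≡ b) →
                      ∀ f a → pushforward k f (k a) ≡ f a
  pushforward-image {k = k} k-inj f a with Finₚ.any? (λ b → k b Fin.≟ k a)
  ... | yes (b , kb≡ka) = cong f (k-inj b a kb≡ka)
  ... | no ∄b = ⊥-elim (∄b (a , refl))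

  pushforward-outside : ∀ {m n} {k : Fin m → Fin n} f j → (∀ a → k a ≢ j) → pushforward k f j ≡ 0#
  pushforward-outside {k = k} f j j∉k with Finₚ.any? (λ a → k a Fin.≟ j)
  ... | yes (a , ka≡j) = ⊥-elim (j∉k a ka≡j)
  ... | no _ = refl

module Polynomials (R : RealField) where
  open OrderedFieldProperties R
  open FieldSolver R
  open FiniteSums R
  open FinSubsets

  infixr 8 _^_
  _^_ : Carrier → ℕ → Carrier
  x ^ ℕ.zero = 1#
  x ^ ℕ.suc e = x * x ^ e

  eval : List Carrier → Carrier → Carrier
  eval [] t = 0#
  eval (b ∷ bs) t = b + t * eval bs t

  DegreeBelow : ℕ → (Carrier → Carrier) → Set
  DegreeBelow k g = Σ (List Carrier) λ bs → length bs ℕ.≤ k × (∀ t → g t ≡ eval bs t)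

  addConstant : Carrier → List Carrier → List Carrier
  addConstant b [] = b ∷ []
  addConstant b (c ∷ cs) = (b + c) ∷ cs

  eval-addConstant : ∀ b cs t → eval (addConstant b cs) t ≡ b + eval cs t
  eval-addConstant b [] t = cong (b +_) (zeroʳ t)
  eval-addConstant b (c ∷ cs) t = +-assoc b c _

  length-addConstant : ∀ {k} b cs → length cs ℕ.≤ ℕ.suc k → length (addConstant b cs) ℕ.≤ ℕ.suc k
  length-addConstant b [] _ = ℕ.s≤s ℕ.z≤n
  length-addConstant b (c ∷ cs) |cs|≤ = |cs|≤

  mulLinear : Carrier → List Carrier → List Carrier
  mulLinear r [] = []
  mulLinear r (b ∷ bs) = - (r * b) ∷ addConstant b (mulLinear r bs)

  eval-mulLinear : ∀ r bs t → eval (mulLinear r bs) t ≡ (t + - r) * eval bs t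
  eval-mulLinear r [] t = sym (zeroʳ _)
  eval-mulLinear r (b ∷ bs) t = begin
    - (r * b) + t * eval (addConstant b (mulLinear r bs)) t  ≡⟨ cong (λ e → - (r * b) + t * e) (eval-addConstant b (mulLinear r bs) t) ⟩
    - (r * b) + t * (b + eval (mulLinear r bs) t)            ≡⟨ cong (λ e → - (r * b) + t * (b + e)) (eval-mulLinear r bs t) ⟩
    - (r * b) + t * (b + (t + - r) * eval bs t)              ≡⟨ expand r b t (eval bs t) ⟩
    (t + - r) * (b + t * eval bs t)                          ∎
    where
    open ≡-Reasoning
    expand : ∀ r b t e → - (r * b) + t * (b + (t + - r) * e) ≡ (t + - r) * (b + t * e)
    expand = solve 4 (λ r b t e → :- (r :* b) :+ t :* (b :+ (t :+ :- r) :* e) := (t :+ :- r) :* (b :+ t :* e)) refl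

  length-mulLinear : ∀ r bs → length (mulLinear r bs) ℕ.≤ ℕ.suc (length bs)
  length-mulLinear r [] = ℕ.z≤n
  length-mulLinear r (b ∷ bs) = ℕ.s≤s (length-addConstant b (mulLinear r bs) (length-mulLinear r bs))

  nodePolynomial : ∀ {N} → (Fin N → Bool) → (Fin N → Carrier) → Carrier → Carrier
  nodePolynomial B τ t = prodF (λ l → if B l then t + - τ l else 1#)

  nodePolynomial-degree : ∀ {N} (B : Fin N → Bool) τ → DegreeBelow (ℕ.suc (count B)) (nodePolynomial B τ)
  nodePolynomial-degree {ℕ.zero} B τ = (1# ∷ []) , ℕ.s≤s ℕ.z≤n , λ t → sym (trans (cong (1# +_) (zeroʳ t)) (+-identityʳ 1#))
  nodePolynomial-degree {ℕ.suc N} B τ with B zero | nodePolynomial-degree (B ∘ suc) (τ ∘ suc)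
  ... | true | bs , |bs|≤ , q≗bs =
    mulLinear (τ zero) bs , ℕₚ.≤-trans (length-mulLinear (τ zero) bs) (ℕ.s≤s |bs|≤) ,
    λ t → trans (cong ((t + - τ zero) *_) (q≗bs t)) (sym (eval-mulLinear (τ zero) bs t))
  ... | false | bs , |bs|≤ , q≗bs = bs , |bs|≤ , λ t → trans (*-idˡ _) (q≗bs t)

  nodePolynomial-root : ∀ {N} (B : Fin N → Bool) τ l → B l ≡ true → nodePolynomial B τ (τ l) ≡ 0#
  nodePolynomial-root B τ l Bl = prodF-zero _ l (subst (λ b → (if b then τ l + - τ l else 1#) ≡ 0#) (sym Bl) (-‿inverseʳ (τ l)))

  nodePolynomial-≢0 : ∀ {N} (B : Fin N → Bool) τ t → (∀ l → B l ≡ true → t ≢ τ l) → nodePolynomial B τ t ≢ 0#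
  nodePolynomial-≢0 B τ t t∉τ[B] = prodF-≢0 _ factor-≢0
    where
    factor-≢0 : ∀ l → (if B l then t + - τ l else 1#) ≢ 0#
    factor-≢0 l with B l in Bl
    ... | false = 0≢1 ∘ sym
    ... | true = y≢x⇒y-x≢0 (t∉τ[B] l Bl)

  nodePolynomial-same-sign : ∀ {N} (B : Fin N → Bool) τ s t →
    (∀ l → B l ≡ true → (τ l < s × τ l < t) ⊎ (s < τ l × t < τ l)) →
    0# < nodePolynomial B τ s * nodePolynomial B τ t
  nodePolynomial-same-sign B τ s t side = subst (0# <_) (sym (prodF-* (factor s) (factor t))) (prodF-pos _ factor-pos)
    where
    factor : Carrier → Fin _ → Carrier
    factor u l = if B l then u + - τ l else 1#
    factor-pos : ∀ l → 0# < factor s l * factor t l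
    factor-pos l with B l in Bl
    ... | false = subst (0# <_) (sym (*-idˡ 1#)) 0<1
    ... | true with side l Bl
    ...   | inj₁ (l<s , l<t) = *-pos (x<y⇒0<y-x l<s) (x<y⇒0<y-x l<t)
    ...   | inj₂ (s<l , t<l) = *-neg-neg (x<y⇒x-y<0 s<l) (x<y⇒x-y<0 t<l)

  degreeBelow-weaken : ∀ {k k′ g} → k ℕ.≤ k′ → DegreeBelow k g → DegreeBelow k′ g
  degreeBelow-weaken k≤k′ (bs , |bs|≤k , g≗bs) = bs , ℕₚ.≤-trans |bs|≤k k≤k′ , g≗bs

module MomentRelations (R : RealField) where
  open OrderedFieldProperties R
  open FieldSolver R
  open FiniteSums R
  open FinSubsets
  open Polynomials R
  open Geometry R using (sumF)

  opposite-signs : ∀ {x y W V} → 0# < W * V → x * W + y * V ≡ 0# → x ≢ 0# ⊎ y ≢ 0# → x * y < 0#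
  opposite-signs {x} {y} {W} {V} 0<WV xW+yV≡0 (inj₁ x≢0) =
    x*y<0⇒x<0 0<WV (subst (_< 0#) (sym xy·WV≡-[xW]²) (0<x⇒-x<0 (x≢0⇒0<x*x xW≢0)))
    where
    open ≡-Reasoning
    xW≢0 : x * W ≢ 0#
    xW≢0 = *-≢0 x≢0 (0<x*y⇒x≢0 0<WV)
    xy·WV≡-[xW]² : x * y * (W * V) ≡ - (x * W * (x * W))
    xy·WV≡-[xW]² = begin
      x * y * (W * V)      ≡⟨ solve 4 (λ x y W V → x :* y :* (W :* V) := x :* W :* (y :* V)) refl x y W V ⟩
      x * W * (y * V)      ≡⟨ cong (x * W *_) (x+y≡0⇒y≡-x xW+yV≡0) ⟩
      x * W * - (x * W)    ≡⟨ sym (-‿distribʳ-* _ _) ⟩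
      - (x * W * (x * W))  ∎
  opposite-signs {x} {y} {W} {V} 0<WV xW+yV≡0 (inj₂ y≢0) =
    subst (_< 0#) (*-comm y x)
      (opposite-signs (subst (0# <_) (*-comm W V) 0<WV) (trans (+-comm _ _) xW+yV≡0) (inj₁ y≢0))

  StrictlyMonotone : ∀ {N} → (Fin N → Carrier) → Set
  StrictlyMonotone τ = ∀ a b → toℕ a ℕ.< toℕ b → τ a < τ b

  strictlyMonotone⇒injective : ∀ {N} {τ : Fin N → Carrier} → StrictlyMonotone τ → ∀ a b → a ≢ b → τ a ≢ τ b
  strictlyMonotone⇒injective τ↑ a b a≢b with ℕₚ.<-cmp (toℕ a) (toℕ b)
  ... | tri< a<b _ _ = <⇒≢ (τ↑ a b a<b)
  ... | tri≈ _ a≡b _ = ⊥-elim (a≢b (Finₚ.toℕ-injective a≡b))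
  ... | tri> _ _ b<a = <⇒≢′ (τ↑ b a b<a)

  -- a record, so that w, τ and c can be inferred from a proof
  record MomentsVanish {N} (d : ℕ) (w τ c : Fin N → Carrier) : Set where
    constructor moments-vanish
    field vanish : ∀ e → e ℕ.< d → sumF (λ a → c a * (w a * τ a ^ e)) ≡ 0#
  open MomentsVanish public

  private
    shifted-moments-vanish : ∀ {d N} {w τ c : Fin N → Carrier} → MomentsVanish d w τ c →
      ∀ bs e → length bs ℕ.+ e ℕ.≤ d → sumF (λ a → c a * (w a * (τ a ^ e * eval bs (τ a)))) ≡ 0#
    shifted-moments-vanish {w = w} {τ} {c} mv [] e _ =
      sumF-zero (λ a → trans (cong (λ u → c a * (w a * u)) (zeroʳ _)) (trans (cong (c a *_) (zeroʳ _)) (zeroʳ _)))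
    shifted-moments-vanish {d} {w = w} {τ} {c} mv (b ∷ bs) e len≤d = begin
      sumF (λ a → c a * (w a * (τ a ^ e * (b + τ a * eval bs (τ a)))))
        ≡⟨ sumF-cong (λ a → split (c a) (w a) (τ a ^ e) b (τ a) (eval bs (τ a))) ⟩
      sumF (λ a → b * moment a + shifted a)
        ≡⟨ sumF-distrib-+ (λ a → b * moment a) shifted ⟩
      sumF (λ a → b * moment a) + sumF shifted
        ≡⟨ cong₂ _+_ (trans (sumF-*ˡ b moment) (trans (cong (b *_) (vanish mv e e<d)) (zeroʳ b)))
                     (shifted-moments-vanish mv bs (ℕ.suc e) (subst (ℕ._≤ d) (sym (ℕₚ.+-suc (length bs) e)) len≤d)) ⟩
      0# + 0#
        ≡⟨ +-idˡ 0# ⟩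
      0# ∎
      where
      open ≡-Reasoning
      moment shifted : Fin _ → Carrier
      moment a = c a * (w a * τ a ^ e)
      shifted a = c a * (w a * (τ a ^ ℕ.suc e * eval bs (τ a)))
      e<d : e ℕ.< d
      e<d = ℕₚ.≤-trans (ℕ.s≤s (ℕₚ.m≤n+m e (length bs))) len≤d
      split : ∀ l w P b t E → l * (w * (P * (b + t * E))) ≡ b * (l * (w * P)) + l * (w * ((t * P) * E))
      split = solve 6 (λ l w P b t E → l :* (w :* (P :* (b :+ t :* E))) := b :* (l :* (w :* P)) :+ l :* (w :* ((t :* P) :* E))) refl

  moments-vanish-on-polynomials : ∀ {d N} {w τ c : Fin N → Carrier} {g} → MomentsVanish d w τ c → DegreeBelow d g →
                                  sumF (λ a → c a * (w a * g (τ a))) ≡ 0#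
  moments-vanish-on-polynomials {d} {w = w} {τ} {c} mv (bs , |bs|≤d , g≗bs) =
    trans (sumF-cong (λ a → cong (λ u → c a * (w a * u)) (trans (g≗bs (τ a)) (sym (*-idˡ _)))))
          (shifted-moments-vanish mv bs 0 (subst (ℕ._≤ d) (sym (ℕₚ.+-identityʳ (length bs))) |bs|≤d))

  -- Pair the relation with the polynomial vanishing at every node but τ_a.
  moments-vanish⇒trivial : ∀ {d N} {w τ c : Fin N → Carrier} → N ℕ.≤ d → MomentsVanish d w τ c →
                           (∀ a → w a ≢ 0#) → StrictlyMonotone τ → ∀ a → c a ≡ 0#
  moments-vanish⇒trivial {d} {N} {w} {τ} {c} N≤d mv w≢0 τ↑ a =
    integralʳ (*-≢0 (w≢0 a) q[τa]≢0) (trans (sym (sumF-single _ a others-vanish)) (moments-vanish-on-polynomials mv q-degree))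
    where
    B : Fin N → Bool
    B = erase (λ _ → true) a
    q : Carrier → Carrier
    q = nodePolynomial B τ
    q-degree : DegreeBelow d q
    q-degree = degreeBelow-weaken (subst (ℕ._≤ d) (sym (trans (count-erase _ a refl) (count-all N))) N≤d)
                                  (nodePolynomial-degree B τ)
    q[τa]≢0 : q (τ a) ≢ 0#
    q[τa]≢0 = nodePolynomial-≢0 B τ (τ a) (λ l Bl → strictlyMonotone⇒injective τ↑ a l (proj₂ (erase-true _ a l Bl) ∘ sym))
    others-vanish : ∀ l → l ≢ a → c l * (w l * q (τ l)) ≡ 0#
    others-vanish l l≢a = trans (cong (λ u → c l * (w l * u)) (nodePolynomial-root B τ l (erase-other _ a l l≢a)))
                                (trans (cong (c l *_) (zeroʳ _)) (zeroʳ _))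

  SignAlternating : ∀ {d} → (Fin (ℕ.suc d) → Carrier) → Set
  SignAlternating {d} c = ∀ (a : Fin d) → c (Fin.inject₁ a) ≢ 0# ⊎ c (suc a) ≢ 0# → c (Fin.inject₁ a) * c (suc a) < 0#

  signAlternating⇒nonzero : ∀ {d} {c : Fin (ℕ.suc d) → Carrier} → SignAlternating c → ∀ a₀ → c a₀ ≢ 0# → ∀ a → c a ≢ 0#
  signAlternating⇒nonzero {c = c} alt a₀ ca₀≢0 =
    ascend-from-zero (λ a → c a ≢ 0#) (λ a ca≢0 → x*y≢0⇒y≢0 (<⇒≢ (alt a (inj₁ ca≢0))))
      (descend-to-zero (λ a → c a ≢ 0#) (λ a ca+1≢0 → x*y≢0⇒x≢0 (<⇒≢ (alt a (inj₂ ca+1≢0)))) a₀ ca₀≢0)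

  -- Pair the relation with the polynomial vanishing at every node but τ_a and τ_(a+1); it has the same
  -- sign at these two nodes.
  moments-vanish⇒signAlternating : ∀ {d} {w τ c : Fin (ℕ.suc d) → Carrier} → MomentsVanish d w τ c →
                                   (∀ a → 0# < w a) → StrictlyMonotone τ → SignAlternating c
  moments-vanish⇒signAlternating {d} {w} {τ} {c} mv 0<w τ↑ a = opposite-signs 0<WV relation
    where
    i j : Fin (ℕ.suc d)
    i = Fin.inject₁ a
    j = suc a
    toℕi≡toℕa : toℕ i ≡ toℕ a
    toℕi≡toℕa = Finₚ.toℕ-inject₁ a
    j≢i : j ≢ i
    j≢i j≡i = ℕₚ.1+n≢n (trans (cong toℕ j≡i) toℕi≡toℕa)
    B : Fin (ℕ.suc d) → Bool
    B = erase (erase (λ _ → true) i) j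
    q : Carrier → Carrier
    q = nodePolynomial B τ
    B-other : ∀ l → l ≢ i → l ≢ j → B l ≡ true
    B-other l l≢i l≢j = trans (erase-other _ j l l≢j) (erase-other _ i l l≢i)
    B-outside : ∀ l → B l ≡ true → l ≢ i × l ≢ j
    B-outside l Bl = let B′l , l≢j = erase-true _ j l Bl in proj₂ (erase-true _ i l B′l) , l≢j
    q-degree : DegreeBelow d q
    q-degree = subst (λ k → DegreeBelow k q)
                     (ℕₚ.suc-injective (trans (cong ℕ.suc (count-erase _ j (erase-other _ i j j≢i)))
                                              (trans (count-erase _ i refl) (count-all (ℕ.suc d)))))
                     (nodePolynomial-degree B τ)
    W V : Carrier
    W = w i * q (τ i)
    V = w j * q (τ j)
    relation : c i * W + c j * V ≡ 0#
    relation = trans (sym (sumF-two (λ l → c l * (w l * q (τ l))) i j (j≢i ∘ sym) others-vanish))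
                     (moments-vanish-on-polynomials mv q-degree)
      where
      others-vanish : ∀ l → l ≢ i → l ≢ j → c l * (w l * q (τ l)) ≡ 0#
      others-vanish l l≢i l≢j = trans (cong (λ u → c l * (w l * u)) (nodePolynomial-root B τ l (B-other l l≢i l≢j)))
                                      (trans (cong (c l *_) (zeroʳ _)) (zeroʳ _))
    side : ∀ l → B l ≡ true → (τ l < τ i × τ l < τ j) ⊎ (τ i < τ l × τ j < τ l)
    side l Bl with B-outside l Bl
    ... | l≢i , l≢j with outside-adjacent a l l≢i l≢j
    ...   | inj₁ l<a = inj₁ (τ↑ l i (subst (toℕ l ℕ.<_) (sym toℕi≡toℕa) l<a) , τ↑ l j (ℕₚ.m<n⇒m<1+n l<a))
    ...   | inj₂ a+1<l = inj₂ (τ↑ i l (subst (ℕ._< toℕ l) (sym toℕi≡toℕa) (ℕₚ.<-trans (ℕₚ.n<1+n _) a+1<l)) , τ↑ j l a+1<l)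
    0<WV : 0# < W * V
    0<WV = subst (0# <_) (regroup (w i) (w j) (q (τ i)) (q (τ j)))
                 (*-pos (*-pos (0<w i) (0<w j)) (nodePolynomial-same-sign B τ (τ i) (τ j) side))
      where
      regroup : ∀ a b x y → a * b * (x * y) ≡ a * x * (b * y)
      regroup = solve 4 (λ a b x y → a :* b :* (x :* y) := a :* x :* (b :* y)) refl

  private
    0<xy⇒0<yz⇒0<xz : ∀ {x y z} → 0# < x * y → 0# < y * z → 0# < x * z
    0<xy⇒0<yz⇒0<xz {x} {y} {z} 0<xy 0<yz =
      0<y*x⇒0<x (x≢0⇒0<x*x y≢0) (subst (0# <_) (regroup x y z) (*-pos 0<xy 0<yz))
      where
      y≢0 : y ≢ 0#
      y≢0 = 0<x*y⇒x≢0 0<yz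
      regroup : ∀ x y z → x * y * (y * z) ≡ x * z * (y * y)
      regroup = solve 3 (λ x y z → x :* y :* (y :* z) := x :* z :* (y :* y)) refl

  signAlternating⇒constant-sign : ∀ {d} {c : Fin (ℕ.suc d) → Carrier} → SignAlternating c → (∀ a → c a ≢ 0#) →
    (β : Fin (ℕ.suc d) → Bool) → (∀ (a : Fin d) → β (suc a) ≡ not (β (Fin.inject₁ a))) →
    ∀ a → 0# < signed (β zero) (c zero) * signed (β a) (c a)
  signAlternating⇒constant-sign {c = c} alt c≢0 β β-alternates =
    ascend-from-zero (λ a → 0# < u zero * u a) (λ a 0<u₀uₐ → 0<xy⇒0<yz⇒0<xz 0<u₀uₐ (0<uₐuₐ₊₁ a)) (x≢0⇒0<x*x u₀≢0)
    where
    u : Fin _ → Carrier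
    u a = signed (β a) (c a)
    u₀≢0 : u zero ≢ 0#
    u₀≢0 u₀≡0 = c≢0 zero (trans (sym (signed-involutive (β zero) (c zero)))
                               (trans (cong (signed (β zero)) u₀≡0) (signed-zero (β zero))))
    0<uₐuₐ₊₁ : ∀ a → 0# < u (Fin.inject₁ a) * u (suc a)
    0<uₐuₐ₊₁ a = subst (0# <_)
      (sym (trans (cong (λ s → u (Fin.inject₁ a) * signed s (c (suc a))) (β-alternates a)) (signed-not (β (Fin.inject₁ a)) _ _)))
      (x<0⇒0<-x (alt a (inj₁ (c≢0 (Fin.inject₁ a)))))

module LinearSystems (R : RealField) where
  open OrderedFieldProperties R
  open FieldSolver R
  open FiniteSums R
  open FinSubsets
  open Geometry R using (sumF)

  record KernelVector {N} (U : Fin N → Bool) (e : ℕ) (E : Fin e → Fin N → Carrier) : Set where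
    field
      vector    : Fin N → Carrier
      supported : ∀ j → U j ≡ false → vector j ≡ 0#
      nonzero   : ∃ λ j → vector j ≢ 0#
      solves    : ∀ k → sumF (λ j → E k j * vector j) ≡ 0#

  private
    pivot : ∀ {N} (U : Fin N → Bool) (a : Fin N → Carrier) →
            (∃ λ j → U j ≡ true × a j ≢ 0#) ⊎ (∀ j → U j ≡ true → a j ≡ 0#)
    pivot U a with Finₚ.any? (λ j → (U j Boolₚ.≟ true) ×-dec ¬? (a j ≟0))
    ... | yes (j , Uj , aj≢0) = inj₁ (j , Uj , aj≢0)
    ... | no no-pivot = inj₂ λ j Uj → decidable-stable (a j ≟0) (λ aj≢0 → no-pivot (j , Uj , aj≢0))

    sumF-*-plus-delta : ∀ {N} (G y : Fin N → Carrier) j c →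
                        sumF (λ l → G l * (y l + delta j c l)) ≡ sumF (λ l → G l * y l) + G j * c
    sumF-*-plus-delta G y j c =
      trans (sumF-cong (λ l → distribˡ (G l) (y l) (delta j c l)))
            (trans (sumF-distrib-+ (λ l → G l * y l) (λ l → G l * delta j c l))
                   (cong (sumF (λ l → G l * y l) +_) (sumF-*delta G j c)))

    sumF-linear : ∀ {N} (G a y : Fin N → Carrier) m →
                  sumF (λ l → (G l + m * a l) * y l) ≡ sumF (λ l → G l * y l) + m * sumF (λ l → a l * y l)
    sumF-linear G a y m =
      trans (sumF-cong (λ l → trans (distribʳ (y l) (G l) (m * a l)) (cong (G l * y l +_) (*-assoc m (a l) (y l)))))
            (trans (sumF-distrib-+ (λ l → G l * y l) (λ l → m * (a l * y l)))
                   (cong (sumF (λ l → G l * y l) +_) (sumF-*ˡ m (λ l → a l * y l))))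

  private
    drop-vanishing-equation : ∀ {N e} {U : Fin N → Bool} {E : Fin (ℕ.suc e) → Fin N → Carrier} →
      (∀ j → U j ≡ true → E zero j ≡ 0#) → KernelVector U e (E ∘ suc) → KernelVector U (ℕ.suc e) E
    drop-vanishing-equation {U = U} {E} E₀≗0 K = record { vector = vector ; supported = supported ; nonzero = nonzero ; solves = solves′ }
      where
      open KernelVector K
      term-vanishes : ∀ j b → U j ≡ b → E zero j * vector j ≡ 0#
      term-vanishes j true Uj = trans (cong (_* vector j) (E₀≗0 j Uj)) (zeroˡ _)
      term-vanishes j false Uj = trans (cong (E zero j *_) (supported j Uj)) (zeroʳ _)
      solves′ : ∀ k → sumF (λ j → E k j * vector j) ≡ 0#
      solves′ zero = sumF-zero (λ j → term-vanishes j (U j) refl)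
      solves′ (suc k) = solves k

    multiplier : ∀ {N e} (E : Fin (ℕ.suc e) → Fin N → Carrier) j₀ → E zero j₀ ≢ 0# → Fin e → Carrier
    multiplier E j₀ pivot≢0 k = - (E (suc k) j₀ * E zero j₀ ⁻¹⟨ pivot≢0 ⟩)

    eliminate : ∀ {N e} (E : Fin (ℕ.suc e) → Fin N → Carrier) j₀ → E zero j₀ ≢ 0# → Fin e → Fin N → Carrier
    eliminate E j₀ pivot≢0 k l = E (suc k) l + multiplier E j₀ pivot≢0 k * E zero l

    back-substitute : ∀ {N e} {U : Fin N → Bool} {E : Fin (ℕ.suc e) → Fin N → Carrier} j₀ → U j₀ ≡ true →
      (pivot≢0 : E zero j₀ ≢ 0#) → KernelVector (erase U j₀) e (eliminate E j₀ pivot≢0) → KernelVector U (ℕ.suc e) E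
    back-substitute {U = U} {E} j₀ Uj₀ pivot≢0 K = record { vector = y ; supported = supported′ ; nonzero = nonzero′ ; solves = solves′ }
      where
      open KernelVector K
      a : Fin _ → Carrier
      a = E zero
      a⁻¹ : Carrier
      a⁻¹ = a j₀ ⁻¹⟨ pivot≢0 ⟩
      S : Carrier
      S = sumF (λ l → a l * vector l)
      y : Fin _ → Carrier
      y l = vector l + delta j₀ (- (a⁻¹ * S)) l
      supported′ : ∀ j → U j ≡ false → y j ≡ 0#
      supported′ j Uj = trans (cong₂ _+_ (supported j (trans (erase-other U j₀ j j≢j₀) Uj)) (delta-other j₀ _ j j≢j₀)) (+-idˡ 0#)
        where
        j≢j₀ : j ≢ j₀
        j≢j₀ refl = true≢false (trans (sym Uj₀) Uj)
      nonzero′ : ∃ λ j → y j ≢ 0#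
      nonzero′ = still-nonzero nonzero
        where
        still-nonzero : (∃ λ l → vector l ≢ 0#) → ∃ λ l → y l ≢ 0#
        still-nonzero (l , vl≢0) = l , λ yl≡0 → vl≢0 (trans (sym (+-identityʳ _)) (trans (cong (vector l +_) (sym (delta-other j₀ _ l l≢j₀))) yl≡0))
          where
          l≢j₀ : l ≢ j₀
          l≢j₀ refl = vl≢0 (supported j₀ (erase-self U j₀))
      solves′ : ∀ k → sumF (λ j → E k j * y j) ≡ 0#
      solves′ zero = trans (sumF-*-plus-delta a vector j₀ _) (cancel (a j₀) a⁻¹ S (*-inverseʳ (a j₀) pivot≢0))
        where
        cancel : ∀ x x⁻¹ s → x * x⁻¹ ≡ 1# → s + x * - (x⁻¹ * s) ≡ 0#
        cancel x x⁻¹ s xx⁻¹≡1 = trans (cong (s +_) (trans (sym (-‿distribʳ-* x (x⁻¹ * s)))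
                                                        (cong -_ (trans (sym (*-assoc x x⁻¹ s)) (trans (cong (_* s) xx⁻¹≡1) (*-idˡ s))))))
                                      (-‿inverseʳ s)
      solves′ (suc k) = begin
        sumF (λ l → G l * y l)                              ≡⟨ sumF-*-plus-delta G vector j₀ _ ⟩
        sumF (λ l → G l * vector l) + G j₀ * - (a⁻¹ * S)    ≡⟨ cong (sumF (λ l → G l * vector l) +_) (regroup (G j₀) a⁻¹ S) ⟩
        sumF (λ l → G l * vector l) + m * S                 ≡⟨ sym (sumF-linear G a vector m) ⟩
        sumF (λ l → eliminate E j₀ pivot≢0 k l * vector l)  ≡⟨ solves k ⟩
        0#                                                  ∎
        where
        open ≡-Reasoning
        G : Fin _ → Carrier
        G = E (suc k)
        m : Carrier
        m = multiplier E j₀ pivot≢0 k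
        regroup : ∀ g x s → g * - (x * s) ≡ - (g * x) * s
        regroup = solve 3 (λ g x s → g :* (:- (x :* s)) := :- (g :* x) :* s) refl

  kernelVector : ∀ {N} (U : Fin N → Bool) e (E : Fin e → Fin N → Carrier) → e ℕ.< count U → KernelVector U e E
  kernelVector U ℕ.zero E 0<count with count-pos U 0<count
  ... | j , Uj = record
    { vector = delta j 1#
    ; supported = λ l Ul → delta-other j 1# l (λ { refl → true≢false (trans (sym Uj) Ul) })
    ; nonzero = j , λ δjj≡0 → 0≢1 (sym (trans (sym (delta-same j 1#)) δjj≡0))
    ; solves = λ () }
  kernelVector U (ℕ.suc e) E e<count with pivot U (E zero)
  ... | inj₂ E₀≗0 = drop-vanishing-equation E₀≗0 (kernelVector U e (E ∘ suc) (ℕₚ.<-trans (ℕₚ.n<1+n e) e<count))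
  ... | inj₁ (j₀ , Uj₀ , pivot≢0) = back-substitute j₀ Uj₀ pivot≢0 (kernelVector (erase U j₀) e (eliminate E j₀ pivot≢0) e<count′)
    where
    e<count′ : e ℕ.< count (erase U j₀)
    e<count′ = ℕₚ.≤-pred (subst (ℕ.suc (ℕ.suc e) ℕ.≤_) (sym (count-erase U j₀ Uj₀)) e<count)

module Construction (R : RealField) (d′ n : ℕ) where
  open OrderedFieldProperties R
  open FieldSolver R
  open FiniteSums R
  open FinSubsets
  open Polynomials R
  open MomentRelations R
  open LinearSystems R
  open Geometry R using (sumF; sum2; Point; module Config)

  d : ℕ
  d = ℕ.suc (ℕ.suc d′)

  M : Carrier
  M = fromℕ (n ℕ.* n)

  y : Fin n → Carrier
  y j = fromℕ (toℕ j)

  x : Fin n → Carrier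
  x j = M + - (y j * y j)

  j²<n² : (j : Fin n) → toℕ j ℕ.* toℕ j ℕ.< n ℕ.* n
  j²<n² j = ℕₚ.*-mono-< (Finₚ.toℕ<n j) (Finₚ.toℕ<n j)

  M-pos : Fin n → 0# < M
  M-pos j = fromℕ-mono-< {0} (ℕₚ.≤-<-trans ℕ.z≤n (j²<n² j))

  -- abstract: t depends on this proof through the inverse, and normalising t must not unfold it
  abstract
    x-pos : ∀ j → 0# < x j
    x-pos j = x<y⇒0<y-x (subst (_< M) (fromℕ-* (toℕ j) (toℕ j)) (fromℕ-mono-< (j²<n² j)))

  x≢0 : ∀ j → x j ≢ 0#
  x≢0 j = <⇒≢′ (x-pos j)

  t : Fin n → Carrier
  t j = y j * x j ⁻¹⟨ x≢0 j ⟩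

  -- t_b − t_a = (y_b − y_a)(M + y_a y_b) / (x_a x_b)
  t-increasing : StrictlyMonotone t
  t-increasing a b a<b =
    0<y-x⇒x<y (subst (0# <_) difference (*-pos (*-pos 0<B-A 0<M+AB) (*-pos (0<x⁻¹ a) (0<x⁻¹ b))))
    where
    open ≡-Reasoning
    A B : Carrier
    A = y a
    B = y b
    x⁻¹ : Fin n → Carrier
    x⁻¹ j = x j ⁻¹⟨ x≢0 j ⟩
    0<x⁻¹ : ∀ j → 0# < x⁻¹ j
    0<x⁻¹ j = ⁻¹-pos (x≢0 j) (x-pos j)
    0<B-A : 0# < B + - A
    0<B-A = x<y⇒0<y-x (fromℕ-mono-< a<b)
    0<M+AB : 0# < M + A * B
    0<M+AB = +-pos-nonneg (M-pos a) (*-nonneg (fromℕ-nonneg (toℕ a)) (fromℕ-nonneg (toℕ b)))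
    difference : (B + - A) * (M + A * B) * (x⁻¹ a * x⁻¹ b) ≡ t b + - t a
    difference = begin
      (B + - A) * (M + A * B) * (x⁻¹ a * x⁻¹ b)
        ≡⟨ expand B A M (x⁻¹ a) (x⁻¹ b) ⟩
      B * x⁻¹ b * (x a * x⁻¹ a) + - (A * x⁻¹ a * (x b * x⁻¹ b))
        ≡⟨ cong₂ (λ u w → B * x⁻¹ b * u + - (A * x⁻¹ a * w)) (*-inverseʳ (x a) (x≢0 a)) (*-inverseʳ (x b) (x≢0 b)) ⟩
      B * x⁻¹ b * 1# + - (A * x⁻¹ a * 1#)
        ≡⟨ cong₂ (λ u w → u + - w) (*-identityʳ _) (*-identityʳ _) ⟩
      t b + - t a ∎
      where
      expand : ∀ B A M ia ib → (B + - A) * (M + A * B) * (ia * ib)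
                               ≡ B * ib * ((M + - (A * A)) * ia) + - (A * ia * ((M + - (B * B)) * ib))
      expand = solve 5 (λ B A M ia ib → (B :+ :- A) :* (M :+ A :* B) :* (ia :* ib)
                                        := B :* ib :* ((M :+ :- (A :* A)) :* ia) :+ :- (A :* ia :* ((M :+ :- (B :* B)) :* ib))) refl

  p : Fin n → Point d
  p j c = x j * t j ^ toℕ c

  open Config p public

  p-coordinate₀ : ∀ j → p j zero ≡ x j
  p-coordinate₀ j = *-identityʳ (x j)

  p-coordinate₁ : ∀ j → p j (suc zero) ≡ y j
  p-coordinate₁ j = begin
    x j * (t j * 1#)                 ≡⟨ cong (x j *_) (*-identityʳ (t j)) ⟩
    x j * (y j * x j ⁻¹⟨ x≢0 j ⟩)    ≡⟨ cong (x j *_) (*-comm (y j) _) ⟩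
    x j * (x j ⁻¹⟨ x≢0 j ⟩ * y j)    ≡⟨ sym (*-assoc _ _ _) ⟩
    x j * x j ⁻¹⟨ x≢0 j ⟩ * y j      ≡⟨ cong (_* y j) (*-inverseʳ (x j) (x≢0 j)) ⟩
    1# * y j                         ≡⟨ *-idˡ (y j) ⟩
    y j                              ∎
    where open ≡-Reasoning

  φ : Fin n → Point d → Carrier
  φ i P = P zero + (y i + y i) * P (suc zero)

  φ-vertex : ∀ i j s → φ i (v j s) ≡ signed s (φ i (p j))
  φ-vertex i j true = refl
  φ-vertex i j false = linear (p j zero) (p j (suc zero)) (y i + y i)
    where
    linear : ∀ a b k → - a + k * - b ≡ - (a + k * b)
    linear = solve 3 (λ a b k → :- a :+ k :* (:- b) := :- (a :+ k :* b)) refl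

  φ-comb : ∀ i μ → φ i (comb μ) ≡ sum2 (λ j s → μ j s * φ i (v j s))
  φ-comb i μ = begin
    comb μ zero + K * comb μ (suc zero)
      ≡⟨ cong (comb μ zero +_) (sym (sum2-*ˡ K (λ j s → μ j s * v j s (suc zero)))) ⟩
    comb μ zero + sum2 (λ j s → K * (μ j s * v j s (suc zero)))
      ≡⟨ sym (sum2-distrib-+ (λ j s → μ j s * v j s zero) (λ j s → K * (μ j s * v j s (suc zero)))) ⟩
    sum2 (λ j s → μ j s * v j s zero + K * (μ j s * v j s (suc zero)))
      ≡⟨ sum2-cong (λ j s → factor (μ j s) (v j s zero) (v j s (suc zero)) K) ⟩
    sum2 (λ j s → μ j s * φ i (v j s)) ∎
    where
    open ≡-Reasoning
    K : Carrier
    K = y i + y i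
    factor : ∀ m a b k → m * a + k * (m * b) ≡ m * (a + k * b)
    factor = solve 4 (λ m a b k → m :* a :+ k :* (m :* b) := m :* (a :+ k :* b)) refl

  φ-p : ∀ i j → φ i (p j) ≡ M + - (y j * y j) + (y i + y i) * y j
  φ-p i j = cong₂ (λ u w → u + (y i + y i) * w) (p-coordinate₀ j) (p-coordinate₁ j)

  y-injective : ∀ {i j} → i ≢ j → y i ≢ y j
  y-injective {i} {j} i≢j with ℕₚ.<-cmp (toℕ i) (toℕ j)
  ... | tri< i<j _ _ = <⇒≢ (fromℕ-mono-< i<j)
  ... | tri≈ _ i≡j _ = ⊥-elim (i≢j (Finₚ.toℕ-injective i≡j))
  ... | tri> _ _ j<i = <⇒≢′ (fromℕ-mono-< j<i)

  φ-p-below : ∀ i j → j ≢ i → φ i (p j) < φ i (p i)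
  φ-p-below i j j≢i = 0<y-x⇒x<y (subst (0# <_) (sym gap) (x≢0⇒0<x*x (y≢x⇒y-x≢0 (y-injective (j≢i ∘ sym)))))
    where
    gap : φ i (p i) + - φ i (p j) ≡ (y i + - y j) * (y i + - y j)
    gap = trans (cong₂ (λ u w → u + - w) (φ-p i i) (φ-p i j)) (square M (y i) (y j))
      where
      square : ∀ M a b → M + - (a * a) + (a + a) * a + - (M + - (b * b) + (a + a) * b) ≡ (a + - b) * (a + - b)
      square = solve 3 (λ M a b → M :+ :- (a :* a) :+ (a :+ a) :* a :+ :- (M :+ :- (b :* b) :+ (a :+ a) :* b)
                                  := (a :+ :- b) :* (a :+ :- b)) refl

  -φ-p-below : ∀ i j → - φ i (p j) < φ i (p i)
  -φ-p-below i j = 0<y-x⇒x<y (subst (0# <_) (sym gap) (+-pos-nonneg (x-pos j) (inj₁ (+-pos-nonneg (M-pos i) rest-nonneg))))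
    where
    rest-nonneg : 0# ≤ (y i * y i + (y i + y i) * y j)
    rest-nonneg = +-nonneg (*-nonneg (y-nonneg i) (y-nonneg i)) (*-nonneg (+-nonneg (y-nonneg i) (y-nonneg i)) (y-nonneg j))
      where
      y-nonneg : ∀ j → 0# ≤ y j
      y-nonneg j = fromℕ-nonneg (toℕ j)
    gap : φ i (p i) + - - φ i (p j) ≡ x j + (M + (y i * y i + (y i + y i) * y j))
    gap = trans (cong₂ (λ u w → u + - - w) (φ-p i i) (φ-p i j)) (expand M (y i) (y j))
      where
      expand : ∀ M a b → M + - (a * a) + (a + a) * a + - - (M + - (b * b) + (a + a) * b)
                         ≡ M + - (b * b) + (M + (a * a + (a + a) * b))
      expand = solve 3 (λ M a b → M :+ :- (a :* a) :+ (a :+ a) :* a :+ :- (:- (M :+ :- (b :* b) :+ (a :+ a) :* b))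
                                  := M :+ :- (b :* b) :+ (M :+ (a :* a :+ (a :+ a) :* b))) refl

  φ-vertex-below : ∀ i s j t → ¬ (j ≡ i × t ≡ s) → signed s (φ i (v j t)) < φ i (p i)
  φ-vertex-below i s j t ≢is rewrite φ-vertex i j t with j Fin.≟ i
  ... | no j≢i = [ (λ e → subst (_< φ i (p i)) (sym e) (φ-p-below i j j≢i))
                 , (λ e → subst (_< φ i (p i)) (sym e) (-φ-p-below i j)) ]′ (signed-signed s t (φ i (p j)))
  ... | yes refl = subst (_< φ i (p i)) (sym (signed-signed-≢ s t (φ i (p i)) (λ t≡s → ≢is (refl , t≡s)))) (-φ-p-below i i)

  all-vertices : AllVertices
  all-vertices i s (μ , 0≤μ , μis≡0 , Σμ≡1 , comb≡vis) =
    <-irrefl (φ i (p i)) (subst (_< φ i (p i)) value (sum2-convex-< μ F (φ i (p i)) 0≤μ Σμ≡1 F-below))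
    where
    open ≡-Reasoning
    F : Fin n → Bool → Carrier
    F j t = signed s (φ i (v j t))
    F-below : ∀ j t → μ j t ≢ 0# → F j t < φ i (p i)
    F-below j t μjt≢0 = φ-vertex-below i s j t (λ { (refl , refl) → μjt≢0 μis≡0 })
    value : sum2 (λ j t → μ j t * F j t) ≡ φ i (p i)
    value = begin
      sum2 (λ j t → μ j t * signed s (φ i (v j t)))  ≡⟨ sum2-cong (λ j t → signed-*ʳ s (μ j t) (φ i (v j t))) ⟩
      sum2 (λ j t → signed s (μ j t * φ i (v j t)))  ≡⟨ sym (sum2-signed s (λ j t → μ j t * φ i (v j t))) ⟩
      signed s (sum2 (λ j t → μ j t * φ i (v j t))) ≡⟨ cong (signed s) (sym (φ-comb i μ)) ⟩
      signed s (φ i (comb μ))                        ≡⟨ cong (signed s) (cong₂ (λ u w → u + (y i + y i) * w) (comb≡vis zero) (comb≡vis (suc zero))) ⟩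
      signed s (φ i (v i s))                         ≡⟨ cong (signed s) (φ-vertex i i s) ⟩
      signed s (signed s (φ i (p i)))                ≡⟨ signed-involutive s _ ⟩
      φ i (p i)                                      ∎

  t-increasing-along : ∀ {m} {k : Fin m → Fin n} → StrictlyIncreasing k → StrictlyMonotone (t ∘ k)
  t-increasing-along {k = k} k↑ a b a<b = t-increasing (k a) (k b) (k↑ a b a<b)

  netWeight : Coeffs → Fin n → Carrier
  netWeight μ j = μ j true + - μ j false

  comb-netWeight : ∀ μ c → comb μ c ≡ sumF (λ j → netWeight μ j * p j c)
  comb-netWeight μ c = sumF-cong (λ j → collect (μ j true) (μ j false) (p j c))
    where
    collect : ∀ a b u → a * u + b * - u ≡ (a + - b) * u
    collect = solve 3 (λ a b u → a :* u :+ b :* (:- u) := (a :+ :- b) :* u) refl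

  netWeight-zero : ∀ (μ : Coeffs) j → μ j true ≡ 0# → μ j false ≡ 0# → netWeight μ j ≡ 0#
  netWeight-zero μ j μjt≡0 μjf≡0 = trans (cong₂ (λ u w → u + - w) μjt≡0 μjf≡0) (trans (+-idˡ _) -0#≈0#)

  netWeight-one-sided : ∀ (μ : Coeffs) j s → μ j (not s) ≡ 0# → netWeight μ j ≡ signed s (μ j s)
  netWeight-one-sided μ j true μjf≡0 = trans (cong (λ u → μ j true + - u) μjf≡0) (trans (cong (μ j true +_) -0#≈0#) (+-identityʳ _))
  netWeight-one-sided μ j false μjt≡0 = trans (cong (_+ - μ j false) μjt≡0) (+-idˡ _)

  pairWeight-one-sided : ∀ (μ : Coeffs) j s → μ j (not s) ≡ 0# → μ j true + μ j false ≡ μ j s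
  pairWeight-one-sided μ j true μjf≡0 = trans (cong (μ j true +_) μjf≡0) (+-identityʳ _)
  pairWeight-one-sided μ j false μjt≡0 = trans (cong (_+ μ j false) μjt≡0) (+-idˡ _)

  comb≡0⇒moments-vanish : ∀ μ → (∀ c → comb μ c ≡ 0#) → ∀ {m} (k : Fin m → Fin n) → StrictlyIncreasing k →
    (∀ j → (∀ a → k a ≢ j) → netWeight μ j ≡ 0#) → MomentsVanish d (x ∘ k) (t ∘ k) (netWeight μ ∘ k)
  comb≡0⇒moments-vanish μ comb≡0 k k↑ off-k≡0 = moments-vanish λ e e<d → let c = Fin.fromℕ< e<d in begin
    sumF (λ a → netWeight μ (k a) * (x (k a) * t (k a) ^ e))
      ≡⟨ sumF-cong (λ a → cong (λ i → netWeight μ (k a) * (x (k a) * t (k a) ^ i)) (sym (Finₚ.toℕ-fromℕ< e<d))) ⟩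
    sumF (λ a → netWeight μ (k a) * p (k a) c)
      ≡⟨ sym (sumF-reindex k (increasing⇒injective k↑) (λ j → netWeight μ j * p j c) (λ j j∉k → trans (cong (_* p j c) (off-k≡0 j j∉k)) (zeroˡ _))) ⟩
    sumF (λ j → netWeight μ j * p j c)
      ≡⟨ sym (comb-netWeight μ c) ⟩
    comb μ c
      ≡⟨ comb≡0 c ⟩
    0# ∎
    where open ≡-Reasoning

  midpoint : Fin n → Coeffs
  midpoint i j s = delta i ½ j

  sum2-midpoint : ∀ i → sum2 (midpoint i) ≡ 1#
  sum2-midpoint i =
    trans (sumF-single (λ j → delta i ½ j + delta i ½ j) i
                       (λ j j≢i → trans (cong₂ _+_ (delta-other i ½ j j≢i) (delta-other i ½ j j≢i)) (+-idˡ 0#)))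
          (trans (cong₂ _+_ (delta-same i ½) (delta-same i ½)) ½+½≡1)

  comb-midpoint : ∀ i c → comb (midpoint i) c ≡ 0#
  comb-midpoint i c = sumF-zero λ j →
    trans (sym (distribˡ (delta i ½ j) (p j c) (- p j c))) (trans (cong (delta i ½ j *_) (-‿inverseʳ (p j c))) (zeroʳ _))

  comb-difference : ∀ μ ν c → comb (λ j s → μ j s + - ν j s) c ≡ comb μ c + - comb ν c
  comb-difference μ ν c =
    trans (sum2-cong (λ j s → trans (distribʳ (v j s c) (μ j s) (- ν j s)) (cong (μ j s * v j s c +_) (sym (-‿distribˡ-* (ν j s) (v j s c))))))
          (sum2-difference (λ j s → μ j s * v j s c) (λ j s → ν j s * v j s c))

  antipodal⇒edge : ∀ S i → S i true ≡ true → S i false ≡ true → SimplexThroughOrigin S → IsEdge S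
  antipodal⇒edge S i Sit Sif (independent , μ , supported , positive , Σμ≡1 , comb≡0) =
    i , λ j s → mk⇔ (only-i j s) (includes-i j s)
    where
    includes-i : ∀ j s → j ≡ i → S j s ≡ true
    includes-i j true refl = Sit
    includes-i j false refl = Sif
    -- μ − midpoint i is an affine dependence among the vertices of S
    ν : Coeffs
    ν j s = μ j s + - midpoint i j s
    ν-supported : SupportedOn ν S
    ν-supported j s Sjs≡false =
      trans (cong₂ (λ u w → u + - w) (supported j s Sjs≡false) (delta-other i ½ j j≢i)) (trans (+-idˡ _) -0#≈0#)
      where
      j≢i : j ≢ i
      j≢i refl = true≢false (trans (sym (includes-i j s refl)) Sjs≡false)
    ν-sum : sum2 ν ≡ 0#
    ν-sum = trans (sum2-difference μ (midpoint i)) (trans (cong₂ (λ u w → u + - w) Σμ≡1 (sum2-midpoint i)) (-‿inverseʳ 1#))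
    ν-comb : ∀ c → comb ν c ≡ 0#
    ν-comb c = trans (comb-difference μ (midpoint i) c)
                     (trans (cong₂ (λ u w → u + - w) (comb≡0 c) (comb-midpoint i c)) (trans (+-idˡ _) -0#≈0#))
    only-i : ∀ j s → S j s ≡ true → j ≡ i
    only-i j s Sjs with j Fin.≟ i
    ... | yes j≡i = j≡i
    ... | no j≢i = ⊥-elim (<⇒≢′ (positive j s Sjs) μjs≡0)
      where
      μjs≡0 : μ j s ≡ 0#
      μjs≡0 = trans (sym (+-identityʳ _))
                    (trans (cong (μ j s +_) (sym (trans (cong -_ (delta-other i ½ j j≢i)) -0#≈0#)))
                           (independent ν ν-supported ν-sum ν-comb j s))

  -- A simplex through the origin without an antipodal pair has exactly d + 1 vertices, with alternating signs.
  module WithoutAntipodalPair (S : VSet) (no-pair : ∀ i → S i true ≡ true → S i false ≡ true → ⊥)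
    (independent : AffinelyIndependent S) (μ : Coeffs) (μ-supported : SupportedOn μ S)
    (μ-positive : ∀ i s → S i s ≡ true → 0# < μ i s) (Σμ≡1 : sum2 μ ≡ 1#) (comb≡0 : ∀ c → comb μ c ≡ 0#) where

    support : Fin n → Bool
    support j = S j true ∨ S j false

    support-true : ∀ j → support j ≡ true → S j true ≡ true ⊎ S j false ≡ true
    support-true j _ with S j true | S j false
    support-true j _  | true | _ = inj₁ refl
    support-true j _  | false | true = inj₂ refl
    support-true j () | false | false

    support-false : ∀ j → support j ≡ false → S j true ≡ false × S j false ≡ false
    support-false j _ with S j true | S j false
    support-false j () | true | _
    support-false j () | false | true
    support-false j _  | false | false = refl , refl

    support-intro : ∀ j s → S j s ≡ true → support j ≡ true
    support-intro j true Sjt rewrite Sjt = refl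
    support-intro j false Sjf rewrite Sjf = Boolₚ.∨-zeroʳ (S j true)

    other-side-false : ∀ j s → S j s ≡ true → S j (not s) ≡ false
    other-side-false j s Sjs with S j (not s) in Sjs′
    ... | false = refl
    ... | true = ⊥-elim (pair s Sjs Sjs′)
      where
      pair : ∀ s → S j s ≡ true → S j (not s) ≡ true → ⊥
      pair true = no-pair j
      pair false Sjf Sjt = no-pair j Sjt Sjf

    ℓ : Fin n → Carrier
    ℓ = netWeight μ

    ℓ-signed : ∀ j s → S j s ≡ true → ℓ j ≡ signed s (μ j s)
    ℓ-signed j s Sjs = netWeight-one-sided μ j s (μ-supported j (not s) (other-side-false j s Sjs))

    ℓ-pos : ∀ j → S j true ≡ true → 0# < ℓ j
    ℓ-pos j Sjt = subst (0# <_) (sym (ℓ-signed j true Sjt)) (μ-positive j true Sjt)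

    ℓ-neg : ∀ j → S j false ≡ true → ℓ j < 0#
    ℓ-neg j Sjf = subst (_< 0#) (sym (ℓ-signed j false Sjf)) (0<x⇒-x<0 (μ-positive j false Sjf))

    ℓ-≢0 : ∀ j → support j ≡ true → ℓ j ≢ 0#
    ℓ-≢0 j Bj = [ <⇒≢′ ∘ ℓ-pos j , <⇒≢ ∘ ℓ-neg j ]′ (support-true j Bj)

    ℓ-off-support : ∀ j → support j ≡ false → ℓ j ≡ 0#
    ℓ-off-support j Bj = let St , Sf = support-false j Bj in netWeight-zero μ j (μ-supported j true St) (μ-supported j false Sf)

    ℓ-off-enumeration : ∀ {m} (E : Enumeration support m) j → (∀ a → Enumeration.index E a ≢ j) → ℓ j ≡ 0#
    ℓ-off-enumeration E j j∉E with support j in Bj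
    ... | true = let a , ka≡j = Enumeration.complete E j Bj in ⊥-elim (j∉E a ka≡j)
    ... | false = ℓ-off-support j Bj

    enumeration-moments : ∀ {m} (E : Enumeration support m) →
      MomentsVanish d (x ∘ Enumeration.index E) (t ∘ Enumeration.index E) (ℓ ∘ Enumeration.index E)
    enumeration-moments E = comb≡0⇒moments-vanish μ comb≡0 (Enumeration.index E) (Enumeration.increasing E) (ℓ-off-enumeration E)

    some-vertex : ∃ λ j → support j ≡ true
    some-vertex with sum2-≢0 μ (λ Σμ≡0 → 0≢1 (trans (sym Σμ≡0) Σμ≡1))
    ... | j , s , μjs≢0 with S j s in Sjs
    ...   | false = ⊥-elim (μjs≢0 (μ-supported j s Sjs))
    ...   | true = j , support-intro j s Sjs

    not-small : count support ℕ.≤ d → ⊥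
    not-small m≤d =
      ℓ-≢0 (index a) (sound a) (moments-vanish⇒trivial m≤d (enumeration-moments E) (x≢0 ∘ index) (t-increasing-along increasing) a)
      where
      E : Enumeration support (count support)
      E = enumerate support
      open Enumeration E
      a : Fin (count support)
      a = proj₁ (complete (proj₁ some-vertex) (proj₂ some-vertex))

    -- d + 1 homogeneous conditions on more than d + 1 unknowns: a nontrivial affine dependence
    not-large : ℕ.suc d ℕ.< count support → ⊥
    not-large d+1<m = vj≢0 vj≡0
      where
      equations : Fin (ℕ.suc d) → Fin n → Carrier
      equations zero j = indicator (S j true) + indicator (S j false)
      equations (suc c) j = (indicator (S j true) + - indicator (S j false)) * p j c
      open KernelVector (kernelVector support (ℕ.suc d) equations d+1<m)
      ν : Coeffs
      ν j s = indicator (S j s) * vector j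
      ν-supported : SupportedOn ν S
      ν-supported j s Sjs≡false = trans (cong (λ b → indicator b * vector j) Sjs≡false) (zeroˡ _)
      ν-sum : sum2 ν ≡ 0#
      ν-sum = trans (sumF-cong (λ j → sym (distribʳ (vector j) (indicator (S j true)) (indicator (S j false))))) (solves zero)
      ν-comb : ∀ c → comb ν c ≡ 0#
      ν-comb c = trans (sumF-cong (λ j → rearrange (indicator (S j true)) (indicator (S j false)) (vector j) (p j c))) (solves (suc c))
        where
        rearrange : ∀ a b z u → a * z * u + b * z * - u ≡ (a + - b) * u * z
        rearrange = solve 4 (λ a b z u → a :* z :* u :+ b :* z :* (:- u) := (a :+ :- b) :* u :* z) refl
      j : Fin n
      j = proj₁ nonzero
      vj≢0 : vector j ≢ 0#
      vj≢0 = proj₂ nonzero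
      Bj : support j ≡ true
      Bj = Boolₚ.¬-not (vj≢0 ∘ supported j)
      vj≡0 : vector j ≡ 0#
      vj≡0 = [ via true , via false ]′ (support-true j Bj)
        where
        via : ∀ s → S j s ≡ true → vector j ≡ 0#
        via s Sjs = trans (sym (*-idˡ _)) (trans (cong (λ b → indicator b * vector j) (sym Sjs)) (independent ν ν-supported ν-sum ν-comb j s))

    module Alternation (E : Enumeration support (ℕ.suc d)) where
      open Enumeration E

      σ : Fin (ℕ.suc d) → Bool
      σ a = S (index a) true

      S-σ : ∀ a → S (index a) (σ a) ≡ true
      S-σ a with S (index a) true in Sat
      ... | true = Sat
      ... | false = [ (λ Sat′ → ⊥-elim (true≢false (trans (sym Sat′) Sat))) , (λ Saf → Saf) ]′ (support-true (index a) (sound a))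

      sign-unique : ∀ a s → S (index a) s ≡ true → s ≡ σ a
      sign-unique a true Sat = sym Sat
      sign-unique a false Saf = sym (other-side-false (index a) false Saf)

      0<signed-ℓ : ∀ a → 0# < signed (σ a) (ℓ (index a))
      0<signed-ℓ a =
        subst (0# <_) (sym (trans (cong (signed (σ a)) (ℓ-signed (index a) (σ a) (S-σ a))) (signed-involutive (σ a) _)))
              (μ-positive _ _ (S-σ a))

      ℓ-alternates : SignAlternating (ℓ ∘ index)
      ℓ-alternates = moments-vanish⇒signAlternating (enumeration-moments E) (x-pos ∘ index) (t-increasing-along increasing)

      σ-step : ∀ (a : Fin d) → σ (suc a) ≡ not (σ (Fin.inject₁ a))
      σ-step a with σ (suc a) Boolₚ.≟ σ (Fin.inject₁ a)
      ... | no σ≢ = Boolₚ.¬-not σ≢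
      ... | yes σ≡ = ⊥-elim (<-asym (ℓ-alternates a (inj₁ (ℓ-≢0 _ (sound _))))
                                   (subst (0# <_) same-sign (*-pos (0<signed-ℓ i) (0<signed-ℓ (suc a)))))
        where
        i : Fin (ℕ.suc d)
        i = Fin.inject₁ a
        same-sign : signed (σ i) (ℓ (index i)) * signed (σ (suc a)) (ℓ (index (suc a))) ≡ ℓ (index i) * ℓ (index (suc a))
        same-sign = trans (cong (λ s → signed (σ i) (ℓ (index i)) * signed s (ℓ (index (suc a)))) σ≡)
                          (signed-same (σ i) (ℓ (index i)) (ℓ (index (suc a))))

      σ-alt : ∀ a → σ a ≡ alt (σ zero) (toℕ a)
      σ-alt = ascend-from-zero (λ a → σ a ≡ alt (σ zero) (toℕ a))
        (λ a σi≡ → trans (σ-step a) (cong not (trans σi≡ (cong (alt (σ zero)) (Finₚ.toℕ-inject₁ a))))) refl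

      vertex⇒listed : ∀ j s → S j s ≡ true → ∃ λ a → index a ≡ j × s ≡ alt (σ zero) (toℕ a)
      vertex⇒listed j s Sjs with complete j (support-intro j s Sjs)
      ... | a , refl = a , refl , trans (sign-unique a s Sjs) (σ-alt a)

      listed⇒vertex : ∀ j s → (∃ λ a → index a ≡ j × s ≡ alt (σ zero) (toℕ a)) → S j s ≡ true
      listed⇒vertex j s (a , refl , s≡alt) = subst (λ s → S (index a) s ≡ true) (sym (trans s≡alt (sym (σ-alt a)))) (S-σ a)

      alternating : IsAlternating S
      alternating = index , increasing , σ zero , λ j s → mk⇔ (vertex⇒listed j s) (listed⇒vertex j s)

    isAlternating : IsAlternating S
    isAlternating with ℕₚ.<-cmp (count support) (ℕ.suc d)
    ... | tri< m<d+1 _ _ = ⊥-elim (not-small (ℕₚ.≤-pred m<d+1))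
    ... | tri≈ _ m≡d+1 _ = Alternation.alternating (subst (Enumeration support) m≡d+1 (enumerate support))
    ... | tri> _ _ d+1<m = ⊥-elim (not-large d+1<m)

  simplex⇒edge-or-alternating : ∀ S → SimplexThroughOrigin S → IsEdge S ⊎ IsAlternating S
  simplex⇒edge-or-alternating S simplex@(independent , μ , μ-supported , μ-positive , Σμ≡1 , comb≡0)
    with Finₚ.any? (λ i → (S i true Boolₚ.≟ true) ×-dec (S i false Boolₚ.≟ true))
  ... | yes (i , Sit , Sif) = inj₁ (antipodal⇒edge S i Sit Sif simplex)
  ... | no no-pair = inj₂ (WithoutAntipodalPair.isAlternating S (λ i Sit Sif → no-pair (i , Sit , Sif))
                                                      independent μ μ-supported μ-positive Σμ≡1 comb≡0)

  edge⇒simplex : ∀ S → IsEdge S → SimplexThroughOrigin S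
  edge⇒simplex S (i , S≡±pᵢ) = independent , midpoint i , supported , positive , sum2-midpoint i , comb-midpoint i
    where
    only-i : ∀ j s → S j s ≡ true → j ≡ i
    only-i j s = Equivalence.to (S≡±pᵢ j s)
    off-i : ∀ j s → j ≢ i → S j s ≡ false
    off-i j s j≢i with S j s in Sjs
    ... | true = ⊥-elim (j≢i (only-i j s Sjs))
    ... | false = refl
    supported : SupportedOn (midpoint i) S
    supported j s Sjs≡false = delta-other i ½ j λ { refl → true≢false (trans (sym (Equivalence.from (S≡±pᵢ i s) refl)) Sjs≡false) }
    positive : ∀ j s → S j s ≡ true → 0# < midpoint i j s
    positive j s Sjs rewrite only-i j s Sjs = subst (0# <_) (sym (delta-same i ½)) ½-pos
    independent : AffinelyIndependent S
    independent μ μ-supported Σμ≡0 comb≡0 j s with j Fin.≟ i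
    ... | no j≢i = μ-supported j s (off-i j s j≢i)
    ... | yes refl = both s
      where
      μ-off : ∀ j s → j ≢ i → μ j s ≡ 0#
      μ-off j s j≢i = μ-supported j s (off-i j s j≢i)
      pair≡0 : μ i true + μ i false ≡ 0#
      pair≡0 = trans (sym (sumF-single (λ j → μ j true + μ j false) i
                                       (λ j j≢i → trans (cong₂ _+_ (μ-off j true j≢i) (μ-off j false j≢i)) (+-idˡ 0#))))
                     Σμ≡0
      net≡0 : netWeight μ i ≡ 0#
      net≡0 = integralʳ (subst (_≢ 0#) (sym (p-coordinate₀ i)) (x≢0 i)) (begin
        netWeight μ i * p i zero                ≡⟨ sym (sumF-single (λ j → netWeight μ j * p j zero) i (λ j j≢i →
                                                     trans (cong (_* p j zero) (netWeight-zero μ j (μ-off j true j≢i) (μ-off j false j≢i))) (zeroˡ _))) ⟩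
        sumF (λ j → netWeight μ j * p j zero)   ≡⟨ sym (comb-netWeight μ zero) ⟩
        comb μ zero                             ≡⟨ comb≡0 zero ⟩
        0#                                      ∎)
        where open ≡-Reasoning
      true-side : μ i true ≡ 0#
      true-side = x+x≡0⇒x≡0 (trans (cong (μ i true +_) (sym (x+-y≡0⇒y≡x net≡0))) pair≡0)
      both : ∀ s → μ i s ≡ 0#
      both true = true-side
      both false = trans (x+-y≡0⇒y≡x net≡0) true-side

  module AlternatingSimplex (S : VSet) (k : Fin (ℕ.suc d) → Fin n) (k↑ : StrictlyIncreasing k) (b : Bool)
    (S≡alt : ∀ j s → (S j s ≡ true) ⇔ (∃ λ a → k a ≡ j × s ≡ alt b (toℕ a))) where

    β : Fin (ℕ.suc d) → Bool
    β a = alt b (toℕ a)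

    β-alternates : ∀ (a : Fin d) → β (suc a) ≡ not (β (Fin.inject₁ a))
    β-alternates a = cong not (cong (alt b) (sym (Finₚ.toℕ-inject₁ a)))

    k-injective : ∀ a a′ → k a ≡ k a′ → a ≡ a′
    k-injective = increasing⇒injective k↑

    S-on : ∀ a → S (k a) (β a) ≡ true
    S-on a = Equivalence.from (S≡alt (k a) (β a)) (a , refl , refl)

    S-false : ∀ j s → ¬ (∃ λ a → k a ≡ j × s ≡ β a) → S j s ≡ false
    S-false j s not-listed with S j s in Sjs
    ... | true = ⊥-elim (not-listed (Equivalence.to (S≡alt j s) Sjs))
    ... | false = refl

    S-opposite : ∀ a s → s ≢ β a → S (k a) s ≡ false
    S-opposite a s s≢βa = S-false (k a) s λ (a′ , ka′≡ka , s≡βa′) → s≢βa (trans s≡βa′ (cong β (k-injective a′ a ka′≡ka)))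

    S-off-image : ∀ j s → (∀ a → k a ≢ j) → S j s ≡ false
    S-off-image j s j∉k = S-false j s λ (a , ka≡j , _) → j∉k a ka≡j

    not-β : ∀ a → not (β a) ≢ β a
    not-β a = Boolₚ.not-¬ refl ∘ sym

    module _ (μ : Coeffs) (μ-supported : SupportedOn μ S) where

      μ-off-image : ∀ j s → (∀ a → k a ≢ j) → μ j s ≡ 0#
      μ-off-image j s j∉k = μ-supported j s (S-off-image j s j∉k)

      μ-opposite : ∀ a → μ (k a) (not (β a)) ≡ 0#
      μ-opposite a = μ-supported (k a) (not (β a)) (S-opposite a (not (β a)) (not-β a))

      netWeight-off-image : ∀ j → (∀ a → k a ≢ j) → netWeight μ j ≡ 0#
      netWeight-off-image j j∉k = netWeight-zero μ j (μ-off-image j true j∉k) (μ-off-image j false j∉k)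

      sum2-along-k : sum2 μ ≡ sumF (λ a → μ (k a) (β a))
      sum2-along-k =
        trans (sumF-reindex k k-injective (λ j → μ j true + μ j false)
                            (λ j j∉k → trans (cong₂ _+_ (μ-off-image j true j∉k) (μ-off-image j false j∉k)) (+-idˡ 0#)))
              (sumF-cong (λ a → pairWeight-one-sided μ (k a) (β a) (μ-opposite a)))

      comb-along-k : ∀ c → comb μ c ≡ sumF (λ a → netWeight μ (k a) * p (k a) c)
      comb-along-k c =
        trans (comb-netWeight μ c)
              (sumF-reindex k k-injective (λ j → netWeight μ j * p j c)
                            (λ j j∉k → trans (cong (_* p j c) (netWeight-off-image j j∉k)) (zeroˡ _)))

    -- For an affine dependence μ on S the net weights along k alternate in sign, so the weights
    -- u_a = μ (k a) (β a) all have one sign unless they all vanish; but they sum to zero.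
    module Dependence (μ : Coeffs) (μ-supported : SupportedOn μ S) (Σμ≡0 : sum2 μ ≡ 0#) (comb≡0 : ∀ c → comb μ c ≡ 0#) where

      ℓ : Fin n → Carrier
      ℓ = netWeight μ

      ℓ∘k-alternates : SignAlternating (ℓ ∘ k)
      ℓ∘k-alternates = moments-vanish⇒signAlternating
        (comb≡0⇒moments-vanish μ comb≡0 k k↑ (netWeight-off-image μ μ-supported)) (x-pos ∘ k) (t-increasing-along k↑)

      u : Fin (ℕ.suc d) → Carrier
      u a = μ (k a) (β a)

      u-signed : ∀ a → signed (β a) (ℓ (k a)) ≡ u a
      u-signed a = trans (cong (signed (β a)) (netWeight-one-sided μ (k a) (β a) (μ-opposite μ μ-supported a)))
                         (signed-involutive (β a) (u a))

      Σu≡0 : sumF u ≡ 0#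
      Σu≡0 = trans (sym (sum2-along-k μ μ-supported)) Σμ≡0

      ℓ∘k≢0⇒⊥ : ∀ a → ℓ (k a) ≢ 0# → ⊥
      ℓ∘k≢0⇒⊥ a ℓₐ≢0 = <-irrefl 0# (subst (0# <_) Σw≡0 (sumF-pos w zero (λ a′ → inj₁ (0<w a′)) (0<w zero)))
        where
        w : Fin (ℕ.suc d) → Carrier
        w a′ = u zero * u a′
        0<w : ∀ a′ → 0# < w a′
        0<w a′ = subst (0# <_) (cong₂ _*_ (u-signed zero) (u-signed a′))
                   (signAlternating⇒constant-sign ℓ∘k-alternates (signAlternating⇒nonzero ℓ∘k-alternates a ℓₐ≢0) β β-alternates a′)
        Σw≡0 : sumF w ≡ 0#
        Σw≡0 = trans (sumF-*ˡ (u zero) u) (trans (cong (u zero *_) Σu≡0) (zeroʳ _))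

      ℓ∘k≡0 : ∀ a → ℓ (k a) ≡ 0#
      ℓ∘k≡0 a = decidable-stable (ℓ (k a) ≟0) (ℓ∘k≢0⇒⊥ a)

    independent : AffinelyIndependent S
    independent μ μ-supported Σμ≡0 comb≡0 j s with Finₚ.any? (λ a → k a Fin.≟ j)
    ... | no j∉k = μ-off-image μ μ-supported j s (λ a ka≡j → j∉k (a , ka≡j))
    ... | yes (a , refl) with s Boolₚ.≟ β a
    ...   | no s≢βa = μ-supported (k a) s (S-opposite a s s≢βa)
    ...   | yes refl = trans (sym (u-signed a)) (trans (cong (signed (β a)) (ℓ∘k≡0 a)) (signed-zero (β a)))
      where open Dependence μ μ-supported Σμ≡0 comb≡0

    -- The kernel vector z of the d coordinate equations in the d + 1 unknowns alternates in sign, so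
    -- the w_a below are positive, and w / Σ w are barycentric coordinates of the origin.
    kernel : KernelVector (λ _ → true) d (λ c a → p (k a) c)
    kernel = kernelVector (λ _ → true) d (λ c a → p (k a) c) (subst (d ℕ.<_) (sym (count-all (ℕ.suc d))) (ℕₚ.n<1+n d))

    open KernelVector kernel using (nonzero; solves) renaming (vector to z)

    z-moments : MomentsVanish d (x ∘ k) (t ∘ k) z
    z-moments = moments-vanish λ e e<d →
      trans (sumF-cong (λ a → trans (*-comm (z a) _) (cong (λ i → x (k a) * t (k a) ^ i * z a) (sym (Finₚ.toℕ-fromℕ< e<d)))))
            (solves (Fin.fromℕ< e<d))

    z-alternates : SignAlternating z
    z-alternates = moments-vanish⇒signAlternating z-moments (x-pos ∘ k) (t-increasing-along k↑)

    w : Fin (ℕ.suc d) → Carrier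
    w a = signed (β zero) (z zero) * signed (β a) (z a)

    0<w : ∀ a → 0# < w a
    0<w = signAlternating⇒constant-sign z-alternates (signAlternating⇒nonzero z-alternates (proj₁ nonzero) (proj₂ nonzero)) β β-alternates

    0<Σw : 0# < sumF w
    0<Σw = sumF-pos w zero (λ a → inj₁ (0<w a)) (0<w zero)

    Σw⁻¹ : Carrier
    Σw⁻¹ = sumF w ⁻¹⟨ <⇒≢′ 0<Σw ⟩

    coefficient : Fin (ℕ.suc d) → Bool → Carrier
    coefficient a s = indicator (does (s Boolₚ.≟ β a)) * (Σw⁻¹ * w a)

    coefficient-on : ∀ a → coefficient a (β a) ≡ Σw⁻¹ * w a
    coefficient-on a = trans (cong (λ b → indicator b * (Σw⁻¹ * w a)) (dec-true (β a Boolₚ.≟ β a) refl)) (*-idˡ _)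

    coefficient-off : ∀ a s → s ≢ β a → coefficient a s ≡ 0#
    coefficient-off a s s≢βa = trans (cong (λ b → indicator b * (Σw⁻¹ * w a)) (dec-false (s Boolₚ.≟ β a) s≢βa)) (zeroˡ _)

    barycentric : Coeffs
    barycentric j s = pushforward k (λ a → coefficient a s) j

    barycentric-k : ∀ a s → barycentric (k a) s ≡ coefficient a s
    barycentric-k a s = pushforward-image k-injective (λ a → coefficient a s) a

    barycentric-supported : SupportedOn barycentric S
    barycentric-supported j s Sjs≡false = on-image j (Finₚ.any? (λ a → k a Fin.≟ j)) Sjs≡false
      where
      on-image : ∀ j → Dec (∃ λ a → k a ≡ j) → S j s ≡ false → barycentric j s ≡ 0#
      on-image j (no j∉k) _ = pushforward-outside (λ a → coefficient a s) j (λ a ka≡j → j∉k (a , ka≡j))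
      on-image _ (yes (a , refl)) Skas≡false =
        trans (barycentric-k a s) (coefficient-off a s λ { refl → true≢false (trans (sym (S-on a)) Skas≡false) })

    barycentric-positive : ∀ j s → S j s ≡ true → 0# < barycentric j s
    barycentric-positive j s Sjs = listed j s (Equivalence.to (S≡alt j s) Sjs)
      where
      listed : ∀ j s → (∃ λ a → k a ≡ j × s ≡ β a) → 0# < barycentric j s
      listed _ _ (a , refl , refl) =
        subst (0# <_) (sym (trans (barycentric-k a (β a)) (coefficient-on a))) (*-pos (⁻¹-pos (<⇒≢′ 0<Σw) 0<Σw) (0<w a))

    barycentric-sum : sum2 barycentric ≡ 1#
    barycentric-sum = begin
      sum2 barycentric                         ≡⟨ sum2-along-k barycentric barycentric-supported ⟩
      sumF (λ a → barycentric (k a) (β a))     ≡⟨ sumF-cong (λ a → trans (barycentric-k a (β a)) (coefficient-on a)) ⟩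
      sumF (λ a → Σw⁻¹ * w a)       ≡⟨ sumF-*ˡ Σw⁻¹ w ⟩
      Σw⁻¹ * sumF w                 ≡⟨ *-comm Σw⁻¹ (sumF w) ⟩
      sumF w * Σw⁻¹                 ≡⟨ *-inverseʳ (sumF w) (<⇒≢′ 0<Σw) ⟩
      1#                            ∎
      where open ≡-Reasoning

    netWeight-barycentric : ∀ a → netWeight barycentric (k a) ≡ (Σw⁻¹ * signed (β zero) (z zero)) * z a
    netWeight-barycentric a = begin
      netWeight barycentric (k a)                  ≡⟨ netWeight-one-sided barycentric (k a) (β a) (μ-opposite barycentric barycentric-supported a) ⟩
      signed (β a) (barycentric (k a) (β a))       ≡⟨ cong (signed (β a)) (trans (barycentric-k a (β a)) (coefficient-on a)) ⟩
      signed (β a) (Σw⁻¹ * (u₀ * u a))             ≡⟨ cong (signed (β a)) (sym (*-assoc Σw⁻¹ u₀ (u a))) ⟩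
      signed (β a) ((Σw⁻¹ * u₀) * u a)             ≡⟨ sym (signed-*ʳ (β a) (Σw⁻¹ * u₀) (u a)) ⟩
      (Σw⁻¹ * u₀) * signed (β a) (u a)             ≡⟨ cong ((Σw⁻¹ * u₀) *_) (signed-involutive (β a) (z a)) ⟩
      (Σw⁻¹ * u₀) * z a                            ∎
      where
      open ≡-Reasoning
      u : Fin (ℕ.suc d) → Carrier
      u a = signed (β a) (z a)
      u₀ : Carrier
      u₀ = u zero

    barycentric-comb : ∀ c → comb barycentric c ≡ 0#
    barycentric-comb c = begin
      comb barycentric c                        ≡⟨ comb-along-k barycentric barycentric-supported c ⟩
      sumF (λ a → netWeight barycentric (k a) * p (k a) c)
        ≡⟨ sumF-cong (λ a → trans (cong (_* p (k a) c) (netWeight-barycentric a)) (regroup m (z a) (p (k a) c))) ⟩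
      sumF (λ a → m * (p (k a) c * z a))        ≡⟨ sumF-*ˡ m (λ a → p (k a) c * z a) ⟩
      m * sumF (λ a → p (k a) c * z a)          ≡⟨ cong (m *_) (solves c) ⟩
      m * 0#                                    ≡⟨ zeroʳ m ⟩
      0#                                        ∎
      where
      open ≡-Reasoning
      m : Carrier
      m = Σw⁻¹ * signed (β zero) (z zero)
      regroup : ∀ m y q → m * y * q ≡ m * (q * y)
      regroup = solve 3 (λ m y q → m :* y :* q := m :* (q :* y)) refl

    origin-inside : OriginInRelInt S
    origin-inside = barycentric , barycentric-supported , barycentric-positive , barycentric-sum , barycentric-comb

  alternating⇒simplex : ∀ S → IsAlternating S → SimplexThroughOrigin S
  alternating⇒simplex S (k , k↑ , b , S≡alt) = independent , origin-inside
    where open AlternatingSimplex S k k↑ b S≡alt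

  isACS : Geometry.IsACS R n d p
  isACS = all-vertices , λ S → mk⇔ (simplex⇒edge-or-alternating S) [ edge⇒simplex S , alternating⇒simplex S ]′


open import Data.Nat using (_≤_)

theorem5p2 : (R : RealField) → (d n : ℕ) → 2 ≤ d → d ≤ n →
    ∃ λ (p : Fin n → Geometry.Point R d) → Geometry.IsACS R n d p
theorem5p2 R (ℕ.suc (ℕ.suc d′)) n (ℕ.s≤s (ℕ.s≤s ℕ.z≤n)) _ = p , isACS
  where open Construction R d′ n
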